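{- Let $k,\ell\ge0$ be integers. The exponential generating function $A(x)=\sum_{n\ge0}A_nx^n/n!$, where $A_n$ is the number of permutations in $\mathcal{S}_n$ avoiding the segmented pattern $a_1a_2\cdots a_k\,a\,a_{k+1}\cdots a_{k+\ell}$, satisfies $$A'(x)=\frac{2-x^k-x^{\ell}}{1-x}A(x)-\frac{1-x^k-x^{\ell}+x^{k+\ell}}{(1-x)^2}$$ with the initial condition $A(0)=1$.
   Context: $\mathcal{S}_n$ is the set of permutations of $\{1,\dots,n\}$ written as words $\pi_1\cdots\pi_n$. An occurrence of $a_1\cdots a_k\,a\,a_{k+1}\cdots a_{k+\ell}$ (poset with only relations $a<a_i$) in $\pi\in\mathcal{S}_n$ is a factor $\pi_i\cdots\pi_{i+k+\ell}$ of $k+\ell+1$ consecutive letters whose $(k+1)$-st letter $\pi_{i+k}$ is smaller than all its other letters. A permutation avoids the pattern if it has no occurrence. -}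

module Defs where

open import Data.Bool using (Bool; true; false; _∧_; _∨_; not)
open import Data.Nat as ℕ using (ℕ; zero; suc; _+_; _<ᵇ_; _≡ᵇ_; _!)
open import Data.Nat.Properties using (_!≢0)
open import Data.List.Base using (List; []; _∷_; length; map; concatMap; applyUpTo; take; drop; filterᵇ; upTo; foldr)
open import Data.Integer using (+_)
open import Data.Rational using (ℚ; 0ℚ; 1ℚ; _/_) renaming (_+_ to _+ℚ_; _-_ to _-ℚ_; _*_ to _*ℚ_)
open import Relation.Binary.PropositionalEquality using (_≡_)
open import Relation.Nullary using (yes; no)

words : ℕ → ℕ → List (List ℕ)
words n zero    = [] ∷ []
words n (suc m) = concatMap (λ a → map (a ∷_) (words n m)) (applyUpTo suc n)

allᵇ : (ℕ → Bool) → List ℕ → Bool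
allᵇ p []       = true
allᵇ p (x ∷ xs) = p x ∧ allᵇ p xs

notIn : ℕ → List ℕ → Bool
notIn x = allᵇ (λ y → not (x ≡ᵇ y))

distinct : List ℕ → Bool
distinct []       = true
distinct (x ∷ xs) = notIn x xs ∧ distinct xs

-- 𝒮ₙ : words of length n over {1,…,n} with distinct letters
--      (= permutations of {1,…,n} written as words)
perms : ℕ → List (List ℕ)
perms n = filterᵇ distinct (words n n)

-- The segmented pattern a₁⋯aₖ a aₖ₊₁⋯aₖ₊ₗ (only relations a < aᵢ)

occursHere : ℕ → ℕ → List ℕ → Bool
occursHere k ℓ w with drop k w
... | []      = false
... | m ∷ rest =
  (suc (k + ℓ) ℕ.≤ᵇ length w)
  ∧ allᵇ (λ y → m <ᵇ y) (take k w)
  ∧ allᵇ (λ y → m <ᵇ y) (take ℓ rest)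

contains : ℕ → ℕ → List ℕ → Bool
contains k ℓ []       = false
contains k ℓ (x ∷ xs) = occursHere k ℓ (x ∷ xs) ∨ contains k ℓ xs

avoids : ℕ → ℕ → List ℕ → Bool
avoids k ℓ π = not (contains k ℓ π)

A : ℕ → ℕ → ℕ → ℕ
A k ℓ n = length (filterᵇ (avoids k ℓ) (perms n))

Series : Set
Series = ℕ → ℚ

infixl 6 _⊕_ _⊖_
infixl 7 _⊛_

_⊕_ : Series → Series → Series
(f ⊕ g) n = f n +ℚ g n

_⊖_ : Series → Series → Series
(f ⊖ g) n = f n -ℚ g n

_⊛_ : Series → Series → Series
(f ⊛ g) n = foldr _+ℚ_ 0ℚ (map (λ i → f i *ℚ g (n ℕ.∸ i)) (upTo (suc n)))

const : ℚ → Series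
const c zero    = c
const c (suc n) = 0ℚ

X^ : ℕ → Series
X^ k n with k ℕ.≟ n
... | yes _ = 1ℚ
... | no  _ = 0ℚ

inv1-x : Series
inv1-x n = 1ℚ

deriv : Series → Series
deriv f n = (+ (suc n) / 1) *ℚ f (suc n)

egf : (ℕ → ℕ) → Series
egf a n = (+ (a n) / (n !)) {{n !≢0}}

infix 4 _≐_

_≐_ : Series → Series → Set
f ≐ g = ∀ n → f n ≡ g n

at0 : Series → ℚ
at0 f = f 0

{-# OPTIONS --safe #-}
module Submission where

-- Split the avoiders of length n + 1 by the position p of their letter 1, which is the minimum of
-- every factor containing it. If k ≤ p and p + ℓ ≤ n, the 1 is the middle letter of an occurrence,
-- so there are none. If p < k, no factor through the 1 is an occurrence and none fits before it,
-- so the p letters before the 1 are arbitrary and the n − p letters after it form an avoider: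
-- n!/(n−p)! · A(n−p) permutations. Reversal swaps k and ℓ and gives n!/p! · A(p) when n − p < ℓ.
-- Where both cases apply every permutation avoids, so counting these positions twice gives
--   A(n+1) + n! c(n) = Σ_{j ≤ n} ([j < k] + [j < ℓ]) · n!/(n−j)! · A(n−j),
-- with c(n) = #{p ≤ n | p < k, n − p < ℓ} = (n+1) − (n+1−k)⁺ − (n+1−ℓ)⁺ + (n+1−k−ℓ)⁺.
-- Divided by n!, this is the coefficient of xⁿ in the differential equation: [j < k] + [j < ℓ] is
-- the coefficient of xʲ in (2 − xᵏ − xˡ)/(1 − x), and c(n) that of xⁿ in (1 − xᵏ − xˡ + xᵏ⁺ˡ)/(1 − x)².
-- Permutations are counted as words with distinct letters; deleting a letter and closing the gap
-- (punchIn) is the bijection behind every count.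

open import Defs
open import Algebra.Bundles using (CommutativeMonoid)
import Algebra.Properties.CommutativeSemigroup as CommutativeSemigroupProperties
import Algebra.Properties.Group as GroupProperties
open import Data.Bool.Base using (Bool; true; false; _∧_; _∨_; not; if_then_else_)
open import Data.Bool.Properties
  using (∧-assoc; ∧-comm; ∧-identityʳ; ∧-zeroʳ; ∨-zeroʳ; ∧-conicalˡ; ∧-conicalʳ; ∧-commutativeMonoid; T-≡; ⇔→≡)
open import Data.Empty using (⊥-elim)
open import Data.Integer.Base as ℤ using (+_)
import Data.Integer.Properties as ℤ
import Data.Integer.Tactic.RingSolver as ℤ-Solver
open import Data.List.Base
  using (List; []; _∷_; [_]; _++_; _∷ʳ_; length; map; concatMap; applyUpTo; filterᵇ; foldr; reverse; take; drop)
open import Data.List.Properties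
  using (length-++; length-map; length-take; length-drop; length-reverse; take-map; drop-map; take++drop≡id;
         ++-assoc; unfold-reverse; reverse-++; reverse-involutive)
open import Data.List.Relation.Unary.All as All using (All; []; _∷_; tail)
open import Data.List.Relation.Unary.All.Properties using (concat⁺; map⁺; applyUpTo⁺₂; drop⁺; ++⁻ˡ; ++⁻ʳ)
open import Data.Nat.Base using (ℕ; zero; suc; _+_; _*_; _∸_; _≤_; _<_; z≤n; s≤s; _<ᵇ_; _≤ᵇ_; _≡ᵇ_; _!; NonZero)
open import Data.Nat.Properties
  using (_≟_; _≤?_; ≤-refl; ≤-reflexive; ≤-trans; ≤-pred; <-trans; <⇒≤; <⇒≱; ≮⇒≥; ≰⇒>; n≤1+n; n<1+n; n≤0⇒n≡0;
         m≤m+n; m≤n+m; suc-injective; +-assoc; +-comm; +-suc; +-identityʳ; +-mono-≤; +-monoʳ-≤;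
         +-cancelˡ-≡; +-cancelˡ-<; *-assoc; *-identityˡ; *-identityʳ; *-zeroʳ; *-distribˡ-+; *-distribʳ-+;
         n∸n≡0; 0∸n≡0; +-∸-assoc; m+n∸m≡n; m∸n+n≡m; m+[n∸m]≡n; m∸[m∸n]≡n; m∸n≤m; m≤n⇒m∸n≡0; ∸-monoˡ-<;
         m≤n⇒m⊓n≡m; ≤ᵇ⇒≤; <⇒<ᵇ; <ᵇ-reflects-<; _!≢0; +-0-commutativeMonoid; module ≤-Reasoning)
import Data.Nat.Tactic.RingSolver as ℕ-Solver
open import Data.Product using (Σ-syntax; _×_; _,_)
open import Data.Rational.Base as ℚ using (ℚ; 0ℚ; 1ℚ; _/_; toℚᵘ) renaming (_+_ to _+ℚ_; _-_ to _-ℚ_; _*_ to _*ℚ_)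
import Data.Rational.Properties as ℚ
open import Data.Rational.Solver using (module +-*-Solver)
open import Data.Rational.Unnormalised.Base as ℚᵘ using (mkℚᵘ; *≡*)
import Data.Rational.Unnormalised.Properties as ℚᵘ
open import Function.Base using (_∘_)
open import Function.Bundles using (mk⇔; Equivalence)
open import Relation.Binary.PropositionalEquality hiding ([_]; setoid)
import Relation.Binary.Reasoning.Setoid as SetoidReasoning
open import Relation.Nullary.Decidable using (yes; no)
open import Relation.Nullary.Reflects using (ofʸ; ofⁿ)

open CommutativeSemigroupProperties (CommutativeMonoid.commutativeSemigroup ∧-commutativeMonoid)
  using () renaming (xy∙z≈y∙xz to ∧-xy∙z≈y∙xz; interchange to ∧-interchange)
open CommutativeSemigroupProperties (CommutativeMonoid.commutativeSemigroup +-0-commutativeMonoid)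
  using () renaming (interchange to +-interchange)
module ℚ* = CommutativeSemigroupProperties (CommutativeMonoid.commutativeSemigroup ℚ.*-1-commutativeMonoid)
module ℚ+ = GroupProperties ℚ.+-0-group

punchIn : ℕ → ℕ → ℕ
punchIn a y = if y <ᵇ a then y else suc y

punchIn-suc : ∀ a y → punchIn (suc a) (suc y) ≡ suc (punchIn a y)
punchIn-suc a y with y <ᵇ a
... | true  = refl
... | false = refl

module ∑-Properties {c ℓ} (M : CommutativeMonoid c ℓ) where

  open CommutativeMonoid M
    using (Carrier; _≈_; _∙_; ε; setoid; ∙-cong; ∙-congˡ; identityˡ; identityʳ; assoc; comm; commutativeSemigroup)
    renaming (refl to ≈-refl; sym to ≈-sym; trans to ≈-trans; reflexive to ≈-reflexive)
  open CommutativeSemigroupProperties commutativeSemigroup using (interchange; x∙yz≈y∙xz)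
  open SetoidReasoning setoid

  ∑< : (ℕ → Carrier) → ℕ → Carrier
  ∑< f zero    = ε
  ∑< f (suc n) = f 0 ∙ ∑< (λ i → f (suc i)) n

  ∑<-cong : ∀ {f g} n → (∀ i → i < n → f i ≈ g i) → ∑< f n ≈ ∑< g n
  ∑<-cong zero    f≈g = ≈-refl
  ∑<-cong (suc n) f≈g = ∙-cong (f≈g 0 (s≤s z≤n)) (∑<-cong n (λ i i<n → f≈g (suc i) (s≤s i<n)))

  ∑<-zero : ∀ f n → (∀ i → i < n → f i ≈ ε) → ∑< f n ≈ ε
  ∑<-zero f zero    f≈ε = ≈-refl
  ∑<-zero f (suc n) f≈ε = begin
    f 0 ∙ ∑< (λ i → f (suc i)) n ≈⟨ ∙-cong (f≈ε 0 (s≤s z≤n)) (∑<-zero _ n (λ i i<n → f≈ε (suc i) (s≤s i<n))) ⟩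
    ε ∙ ε                        ≈⟨ identityˡ ε ⟩
    ε                            ∎

  ∑<-distrib : ∀ f g n → ∑< (λ i → f i ∙ g i) n ≈ ∑< f n ∙ ∑< g n
  ∑<-distrib f g zero    = ≈-sym (identityˡ ε)
  ∑<-distrib f g (suc n) = begin
    (f 0 ∙ g 0) ∙ ∑< (λ i → f (suc i) ∙ g (suc i)) n                ≈⟨ ∙-congˡ (∑<-distrib _ _ n) ⟩
    (f 0 ∙ g 0) ∙ (∑< (λ i → f (suc i)) n ∙ ∑< (λ i → g (suc i)) n) ≈⟨ interchange _ _ _ _ ⟩
    ∑< f (suc n) ∙ ∑< g (suc n)                                     ∎

  ∑<-last : ∀ f n → ∑< f (suc n) ≈ ∑< f n ∙ f n
  ∑<-last f zero    = ≈-trans (identityʳ (f 0)) (≈-sym (identityˡ (f 0)))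
  ∑<-last f (suc n) = ≈-trans (∙-congˡ (∑<-last _ n)) (≈-sym (assoc _ _ _))

  ∑<-swap : ∀ (f : ℕ → ℕ → Carrier) n m → ∑< (λ i → ∑< (f i) m) n ≈ ∑< (λ j → ∑< (λ i → f i j) n) m
  ∑<-swap f zero    m = ≈-sym (∑<-zero _ m (λ _ _ → ≈-refl))
  ∑<-swap f (suc n) m = begin
    ∑< (f 0) m ∙ ∑< (λ i → ∑< (f (suc i)) m) n         ≈⟨ ∙-congˡ (∑<-swap (λ i → f (suc i)) n m) ⟩
    ∑< (f 0) m ∙ ∑< (λ j → ∑< (λ i → f (suc i) j) n) m ≈⟨ ≈-sym (∑<-distrib (f 0) (λ j → ∑< (λ i → f (suc i) j) n) m) ⟩
    ∑< (λ j → ∑< (λ i → f i j) (suc n)) m              ∎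

  ∑<-reflect : ∀ f n → ∑< f (suc n) ≈ ∑< (λ j → f (n ∸ j)) (suc n)
  ∑<-reflect f zero    = ≈-refl
  ∑<-reflect f (suc n) = begin
    f 0 ∙ ∑< (λ i → f (suc i)) (suc n)
      ≈⟨ ∙-congˡ (∑<-reflect (λ i → f (suc i)) n) ⟩
    f 0 ∙ ∑< (λ j → f (suc (n ∸ j))) (suc n)
      ≈⟨ comm _ _ ⟩
    ∑< (λ j → f (suc (n ∸ j))) (suc n) ∙ f 0
      ≈⟨ ∙-cong (∑<-cong (suc n) shift) (≈-reflexive (cong f (sym (n∸n≡0 (suc n))))) ⟩
    ∑< (λ j → f (suc n ∸ j)) (suc n) ∙ f (suc n ∸ suc n)
      ≈⟨ ≈-sym (∑<-last (λ j → f (suc n ∸ j)) (suc n)) ⟩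
    ∑< (λ j → f (suc n ∸ j)) (suc (suc n)) ∎
    where
    shift : ∀ j → j < suc n → f (suc (n ∸ j)) ≈ f (suc n ∸ j)
    shift j j<sn = ≈-reflexive (cong f (sym (+-∸-assoc 1 (≤-pred j<sn))))

  ∑<-punchIn : ∀ f a n → a ≤ n → ∑< f (suc n) ≈ f a ∙ ∑< (λ y → f (punchIn a y)) n
  ∑<-punchIn f zero    n       a≤n       = ≈-refl
  ∑<-punchIn f (suc a) (suc n) (s≤s a≤n) = begin
    f 0 ∙ ∑< (λ i → f (suc i)) (suc n)
      ≈⟨ ∙-congˡ (∑<-punchIn (λ i → f (suc i)) a n a≤n) ⟩
    f 0 ∙ (f (suc a) ∙ ∑< (λ y → f (suc (punchIn a y))) n)
      ≈⟨ x∙yz≈y∙xz _ _ _ ⟩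
    f (suc a) ∙ (f 0 ∙ ∑< (λ y → f (suc (punchIn a y))) n)
      ≈⟨ ∙-congˡ (∙-congˡ (∑<-cong n (λ y _ → ≈-reflexive (cong f (sym (punchIn-suc a y)))))) ⟩
    f (suc a) ∙ ∑< (λ y → f (punchIn (suc a) y)) (suc n) ∎

  ∑<-foldr : ∀ (f : ℕ → Carrier) (g : ℕ → ℕ) n → foldr _∙_ ε (map f (applyUpTo g n)) ≈ ∑< (λ i → f (g i)) n
  ∑<-foldr f g zero    = ≈-refl
  ∑<-foldr f g (suc n) = ∙-congˡ (∑<-foldr f (λ i → g (suc i)) n)

open ∑-Properties +-0-commutativeMonoid

module ℚ∑ = ∑-Properties ℚ.+-0-commutativeMonoid

∑<-const : ∀ c n → ∑< (λ _ → c) n ≡ n * c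
∑<-const c zero    = refl
∑<-const c (suc n) = cong (_+_ c) (∑<-const c n)

∑<-*ˡ : ∀ c f n → ∑< (λ i → c * f i) n ≡ c * ∑< f n
∑<-*ˡ c f zero    = sym (*-zeroʳ c)
∑<-*ˡ c f (suc n) = trans (cong (_+_ (c * f 0)) (∑<-*ˡ c (λ i → f (suc i)) n)) (sym (*-distribˡ-+ c (f 0) _))

-- Counting words

χ : Bool → ℕ
χ true  = 1
χ false = 0

count : (List ℕ → Bool) → List (List ℕ) → ℕ
count P L = length (filterᵇ P L)

count-∷ : ∀ P w L → count P (w ∷ L) ≡ χ (P w) + count P L
count-∷ P w L with P w
... | true  = refl
... | false = refl

count-++ : ∀ P L M → count P (L ++ M) ≡ count P L + count P M
count-++ P []      M = refl
count-++ P (w ∷ L) M = begin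
  count P (w ∷ L ++ M)              ≡⟨ count-∷ P w (L ++ M) ⟩
  χ (P w) + count P (L ++ M)        ≡⟨ cong (_+_ (χ (P w))) (count-++ P L M) ⟩
  χ (P w) + (count P L + count P M) ≡⟨ +-assoc (χ (P w)) _ _ ⟨
  (χ (P w) + count P L) + count P M ≡⟨ cong (_+ count P M) (count-∷ P w L) ⟨
  count P (w ∷ L) + count P M       ∎
  where open ≡-Reasoning

count-map : ∀ P f L → count P (map f L) ≡ count (λ w → P (f w)) L
count-map P f []      = refl
count-map P f (w ∷ L) = begin
  count P (f w ∷ map f L)               ≡⟨ count-∷ P (f w) (map f L) ⟩
  χ (P (f w)) + count P (map f L)       ≡⟨ cong (_+_ (χ (P (f w)))) (count-map P f L) ⟩
  χ (P (f w)) + count (λ w → P (f w)) L ≡⟨ count-∷ (λ w → P (f w)) w L ⟨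
  count (λ w → P (f w)) (w ∷ L)         ∎
  where open ≡-Reasoning

count-concatMap : ∀ P (f : ℕ → List (List ℕ)) xs →
                  count P (concatMap f xs) ≡ foldr _+_ 0 (map (λ x → count P (f x)) xs)
count-concatMap P f []       = refl
count-concatMap P f (x ∷ xs) =
  trans (count-++ P (f x) (concatMap f xs)) (cong (_+_ (count P (f x))) (count-concatMap P f xs))

count-cong : ∀ {P Q L} → All (λ w → P w ≡ Q w) L → count P L ≡ count Q L
count-cong {P} {Q} {[]}    []           = refl
count-cong {P} {Q} {w ∷ L} (Pw≡Qw ∷ eqs) = begin
  count P (w ∷ L)     ≡⟨ count-∷ P w L ⟩
  χ (P w) + count P L ≡⟨ cong₂ (λ b n → χ b + n) Pw≡Qw (count-cong eqs) ⟩
  χ (Q w) + count Q L ≡⟨ count-∷ Q w L ⟨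
  count Q (w ∷ L)     ∎
  where open ≡-Reasoning

count-filterᵇ : ∀ P Q L → count P (filterᵇ Q L) ≡ count (λ w → Q w ∧ P w) L
count-filterᵇ P Q []      = refl
count-filterᵇ P Q (w ∷ L) rewrite count-∷ (λ w → Q w ∧ P w) w L with Q w
... | true  = trans (count-∷ P w (filterᵇ Q L)) (cong (_+_ (χ (P w))) (count-filterᵇ P Q L))
... | false = count-filterᵇ P Q L

χ-∧-≤ : ∀ x y → χ (x ∧ y) ≤ χ x
χ-∧-≤ true  true  = ≤-refl
χ-∧-≤ true  false = z≤n
χ-∧-≤ false y     = z≤n

count-∧-≤ : ∀ (P Q : List ℕ → Bool) L → count (λ w → P w ∧ Q w) L ≤ count P L
count-∧-≤ P Q []      = z≤n
count-∧-≤ P Q (w ∷ L) rewrite count-∷ (λ w → P w ∧ Q w) w L | count-∷ P w L =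
  +-mono-≤ (χ-∧-≤ (P w) (Q w)) (count-∧-≤ P Q L)

count-split : ∀ P (Q : ℕ → List ℕ → Bool) R M L →
              All (λ w → χ (P w) ≡ ∑< (λ p → χ (Q p w)) M + χ (R w)) L →
              count P L ≡ ∑< (λ p → count (Q p) L) M + count R L
count-split P Q R M []      []         = sym (cong (_+ 0) (∑<-zero _ M (λ _ _ → refl)))
count-split P Q R M (w ∷ L) (Pw≡ ∷ P≡) = begin
  count P (w ∷ L)
    ≡⟨ count-∷ P w L ⟩
  χ (P w) + count P L
    ≡⟨ cong₂ _+_ Pw≡ (count-split P Q R M L P≡) ⟩
  (∑< (λ p → χ (Q p w)) M + χ (R w)) + (∑< (λ p → count (Q p) L) M + count R L)
    ≡⟨ +-interchange (∑< (λ p → χ (Q p w)) M) _ _ _ ⟩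
  (∑< (λ p → χ (Q p w)) M + ∑< (λ p → count (Q p) L) M) + (χ (R w) + count R L)
    ≡⟨ cong₂ _+_ (∑<-distrib _ _ M) (count-∷ R w L) ⟨
  ∑< (λ p → χ (Q p w) + count (Q p) L) M + count R (w ∷ L)
    ≡⟨ cong (_+ count R (w ∷ L)) (∑<-cong M (λ p _ → count-∷ (Q p) w L)) ⟨
  ∑< (λ p → count (Q p) (w ∷ L)) M + count R (w ∷ L) ∎
  where open ≡-Reasoning

countWords : (List ℕ → Bool) → ℕ → ℕ → ℕ
countWords P N m = count P (words N m)

IsWord : ℕ → List ℕ → Set
IsWord m w = length w ≡ m × All (0 <_) w

words-isWord : ∀ N m → All (IsWord m) (words N m)
words-isWord N zero    = (refl , []) ∷ []
words-isWord N (suc m) = concat⁺ (map⁺ (applyUpTo⁺₂ _ N λ a →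
  map⁺ (All.map (λ { (len , pos) → cong suc len , s≤s z≤n ∷ pos }) (words-isWord N m))))

countWords-cong : ∀ {P Q} N m → (∀ w → IsWord m w → P w ≡ Q w) → countWords P N m ≡ countWords Q N m
countWords-cong N m P≡Q = count-cong (All.map (P≡Q _) (words-isWord N m))

countWords-none : ∀ P N m → (∀ w → IsWord m w → P w ≡ false) → countWords P N m ≡ 0
countWords-none P N m P≡false = trans (countWords-cong N m P≡false) (count-false (words N m))
  where
  count-false : ∀ L → count (λ _ → false) L ≡ 0
  count-false []      = refl
  count-false (_ ∷ L) = count-false L

countWords-∷ : ∀ P N m → countWords P N (suc m) ≡ ∑< (λ a → countWords (λ w → P (suc a ∷ w)) N m) N
countWords-∷ P N m = begin
  count P (concatMap (λ a → map (a ∷_) (words N m)) (applyUpTo suc N))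
    ≡⟨ count-concatMap P _ (applyUpTo suc N) ⟩
  foldr _+_ 0 (map (λ a → count P (map (a ∷_) (words N m))) (applyUpTo suc N))
    ≡⟨ ∑<-foldr _ suc N ⟩
  ∑< (λ a → count P (map (suc a ∷_) (words N m))) N
    ≡⟨ ∑<-cong N (λ a _ → count-map P (suc a ∷_) (words N m)) ⟩
  ∑< (λ a → countWords (λ w → P (suc a ∷ w)) N m) N ∎
  where open ≡-Reasoning

countWords-∷ʳ : ∀ P N m → countWords P N (suc m) ≡ ∑< (λ a → countWords (λ w → P (w ∷ʳ suc a)) N m) N
countWords-∷ʳ P N zero    = trans (countWords-∷ P N zero) (∑<-cong N λ a _ →
  trans (count-∷ (λ w → P (suc a ∷ w)) [] []) (sym (count-∷ (λ w → P (w ∷ʳ suc a)) [] [])))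
countWords-∷ʳ P N (suc m) = begin
  countWords P N (suc (suc m))
    ≡⟨ countWords-∷ P N (suc m) ⟩
  ∑< (λ b → countWords (λ w → P (suc b ∷ w)) N (suc m)) N
    ≡⟨ ∑<-cong N (λ b _ → countWords-∷ʳ (λ w → P (suc b ∷ w)) N m) ⟩
  ∑< (λ b → ∑< (λ a → countWords (λ w → P (suc b ∷ w ∷ʳ suc a)) N m) N) N
    ≡⟨ ∑<-swap (λ b a → countWords (λ w → P (suc b ∷ w ∷ʳ suc a)) N m) N N ⟩
  ∑< (λ a → ∑< (λ b → countWords (λ w → P (suc b ∷ w ∷ʳ suc a)) N m) N) N
    ≡⟨ ∑<-cong N (λ a _ → countWords-∷ (λ w → P (w ∷ʳ suc a)) N m) ⟨
  ∑< (λ a → countWords (λ w → P (w ∷ʳ suc a)) N (suc m)) N ∎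
  where open ≡-Reasoning

countWords-reverse : ∀ P N m → countWords (λ w → P (reverse w)) N m ≡ countWords P N m
countWords-reverse P N zero    = trans (count-∷ (λ w → P (reverse w)) [] []) (sym (count-∷ P [] []))
countWords-reverse P N (suc m) = begin
  countWords (λ w → P (reverse w)) N (suc m)
    ≡⟨ countWords-∷ (λ w → P (reverse w)) N m ⟩
  ∑< (λ a → countWords (λ w → P (reverse (suc a ∷ w))) N m) N
    ≡⟨ ∑<-cong N (λ a _ → countWords-cong N m (λ w _ → cong P (unfold-reverse (suc a) w))) ⟩
  ∑< (λ a → countWords (λ w → P (reverse w ∷ʳ suc a)) N m) N
    ≡⟨ ∑<-cong N (λ a _ → countWords-reverse (λ w → P (w ∷ʳ suc a)) N m) ⟩
  ∑< (λ a → countWords (λ w → P (w ∷ʳ suc a)) N m) N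
    ≡⟨ countWords-∷ʳ P N m ⟨
  countWords P N (suc m) ∎
  where open ≡-Reasoning

≡ᵇ-refl : ∀ a → (a ≡ᵇ a) ≡ true
≡ᵇ-refl zero    = refl
≡ᵇ-refl (suc a) = ≡ᵇ-refl a

≡ᵇ-comm : ∀ x y → (x ≡ᵇ y) ≡ (y ≡ᵇ x)
≡ᵇ-comm zero    zero    = refl
≡ᵇ-comm zero    (suc y) = refl
≡ᵇ-comm (suc x) zero    = refl
≡ᵇ-comm (suc x) (suc y) = ≡ᵇ-comm x y

punchIn-≡ᵇ : ∀ a x y → (punchIn a x ≡ᵇ punchIn a y) ≡ (x ≡ᵇ y)
punchIn-≡ᵇ zero    x       y       = refl
punchIn-≡ᵇ (suc a) zero    zero    = refl
punchIn-≡ᵇ (suc a) zero    (suc y) rewrite punchIn-suc a y = refl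
punchIn-≡ᵇ (suc a) (suc x) zero    rewrite punchIn-suc a x = refl
punchIn-≡ᵇ (suc a) (suc x) (suc y) rewrite punchIn-suc a x | punchIn-suc a y = punchIn-≡ᵇ a x y

punchIn-≢ : ∀ a y → (a ≡ᵇ punchIn a y) ≡ false
punchIn-≢ zero    y       = refl
punchIn-≢ (suc a) zero    = refl
punchIn-≢ (suc a) (suc y) rewrite punchIn-suc a y = punchIn-≢ a y

punchIn-<ᵇ : ∀ a x y → (punchIn a x <ᵇ punchIn a y) ≡ (x <ᵇ y)
punchIn-<ᵇ zero    x       y       = refl
punchIn-<ᵇ (suc a) zero    zero    = refl
punchIn-<ᵇ (suc a) zero    (suc y) rewrite punchIn-suc a y = refl
punchIn-<ᵇ (suc a) (suc x) zero    = refl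
punchIn-<ᵇ (suc a) (suc x) (suc y) rewrite punchIn-suc a x | punchIn-suc a y = punchIn-<ᵇ a x y

≤-punchIn : ∀ a y → y ≤ punchIn a y
≤-punchIn a y with y <ᵇ a
... | true  = ≤-refl
... | false = n≤1+n y

punchIn-positive : ∀ a σ → All (0 <_) σ → All (0 <_) (map (punchIn a) σ)
punchIn-positive a σ pos = map⁺ (All.map (λ {y} 0<y → ≤-trans 0<y (≤-punchIn a y)) pos)

notIn-punchIn : ∀ a x σ → notIn (punchIn a x) (map (punchIn a) σ) ≡ notIn x σ
notIn-punchIn a x []      = refl
notIn-punchIn a x (y ∷ σ) rewrite punchIn-≡ᵇ a x y | notIn-punchIn a x σ = refl

countWords-relabel : ∀ a N → a ≤ N → ∀ m Q →
  countWords (λ w → notIn (suc a) w ∧ (distinct w ∧ Q w)) (suc N) m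
    ≡ countWords (λ σ → distinct σ ∧ Q (map (punchIn (suc a)) σ)) N m
countWords-relabel a N a≤N zero    Q =
  trans (count-∷ (λ w → notIn (suc a) w ∧ (distinct w ∧ Q w)) [] [])
        (sym (count-∷ (λ σ → distinct σ ∧ Q (map (punchIn (suc a)) σ)) [] []))
countWords-relabel a N a≤N (suc m) Q = begin
  countWords (λ w → notIn (suc a) w ∧ (distinct w ∧ Q w)) (suc N) (suc m)
    ≡⟨ countWords-∷ _ (suc N) m ⟩
  ∑< first (suc N)
    ≡⟨ ∑<-punchIn first a N a≤N ⟩
  first a + ∑< (λ c → first (punchIn a c)) N
    ≡⟨ cong₂ _+_ first-missing (∑<-cong N (λ c _ → first-punchIn c)) ⟩
  ∑< (λ c → countWords (λ σ → distinct (suc c ∷ σ) ∧ Q (map (punchIn (suc a)) (suc c ∷ σ))) N m) N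
    ≡⟨ countWords-∷ _ N m ⟨
  countWords (λ σ → distinct σ ∧ Q (map (punchIn (suc a)) σ)) N (suc m) ∎
  where
  open ≡-Reasoning
  first : ℕ → ℕ
  first b = countWords (λ w → notIn (suc a) (suc b ∷ w) ∧ (distinct (suc b ∷ w) ∧ Q (suc b ∷ w))) (suc N) m

  first-missing : first a ≡ 0
  first-missing = countWords-none _ (suc N) m λ w _ →
    cong (λ x → (not x ∧ notIn (suc a) w) ∧ (distinct (suc a ∷ w) ∧ Q (suc a ∷ w))) (≡ᵇ-refl a)

  first-punchIn : ∀ c → first (punchIn a c) ≡ countWords (λ σ → distinct (suc c ∷ σ) ∧ Q (map (punchIn (suc a)) (suc c ∷ σ))) N m
  first-punchIn c = begin
    first (punchIn a c)
      ≡⟨ countWords-cong (suc N) m (λ w _ →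
           cong (λ x → (not x ∧ notIn (suc a) w) ∧ ((notIn b w ∧ distinct w) ∧ Q (b ∷ w))) (punchIn-≢ a c)) ⟩
    countWords (λ w → notIn (suc a) w ∧ ((notIn b w ∧ distinct w) ∧ Q (b ∷ w))) (suc N) m
      ≡⟨ countWords-cong (suc N) m (λ w _ → cong (notIn (suc a) w ∧_) (∧-xy∙z≈y∙xz (notIn b w) (distinct w) (Q (b ∷ w)))) ⟩
    countWords (λ w → notIn (suc a) w ∧ (distinct w ∧ (notIn b w ∧ Q (b ∷ w)))) (suc N) m
      ≡⟨ countWords-relabel a N a≤N m (λ w → notIn b w ∧ Q (b ∷ w)) ⟩
    countWords (λ σ → distinct σ ∧ (notIn b (map pI σ) ∧ Q (b ∷ map pI σ))) N m
      ≡⟨ cong (λ x → countWords (λ σ → distinct σ ∧ (notIn x (map pI σ) ∧ Q (x ∷ map pI σ))) N m) (punchIn-suc a c) ⟨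
    countWords (λ σ → distinct σ ∧ (notIn (pI (suc c)) (map pI σ) ∧ Q (map pI (suc c ∷ σ)))) N m
      ≡⟨ countWords-cong N m (λ σ _ → cong (λ x → distinct σ ∧ (x ∧ Q (map pI (suc c ∷ σ)))) (notIn-punchIn (suc a) (suc c) σ)) ⟩
    countWords (λ σ → distinct σ ∧ (notIn (suc c) σ ∧ Q (map pI (suc c ∷ σ)))) N m
      ≡⟨ countWords-cong N m (λ σ _ → ∧-xy∙z≈y∙xz (notIn (suc c) σ) (distinct σ) _) ⟨
    countWords (λ σ → distinct (suc c ∷ σ) ∧ Q (map pI (suc c ∷ σ))) N m ∎
    where
    pI : ℕ → ℕ
    pI = punchIn (suc a)
    b : ℕ
    b = suc (punchIn a c)

fallingFactorial : ℕ → ℕ → ℕ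
fallingFactorial n       zero    = 1
fallingFactorial zero    (suc k) = 0
fallingFactorial (suc n) (suc k) = suc n * fallingFactorial n k

fallingFactorial-excess : ∀ n → fallingFactorial n (suc n) ≡ 0
fallingFactorial-excess zero    = refl
fallingFactorial-excess (suc n) = trans (cong (suc n *_) (fallingFactorial-excess n)) (*-zeroʳ (suc n))

fallingFactorial-diagonal : ∀ n → fallingFactorial n n ≡ n !
fallingFactorial-diagonal zero    = refl
fallingFactorial-diagonal (suc n) = cong (suc n *_) (fallingFactorial-diagonal n)

fallingFactorial-! : ∀ n j → j ≤ n → fallingFactorial n j * (n ∸ j) ! ≡ n !
fallingFactorial-! n       zero    _         = +-identityʳ (n !)
fallingFactorial-! (suc n) (suc j) (s≤s j≤n) =
  trans (*-assoc (suc n) (fallingFactorial n j) _) (cong (suc n *_) (fallingFactorial-! n j j≤n))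

countWords-distinct : ∀ N m → countWords distinct N m ≡ fallingFactorial N m
countWords-distinct N       zero    = refl
countWords-distinct zero    (suc m) = refl
countWords-distinct (suc N) (suc m) = begin
  countWords distinct (suc N) (suc m)
    ≡⟨ countWords-∷ distinct (suc N) m ⟩
  ∑< (λ a → countWords (λ w → distinct (suc a ∷ w)) (suc N) m) (suc N)
    ≡⟨ ∑<-cong (suc N) (λ a a<1+N → first-letter a (≤-pred a<1+N)) ⟩
  ∑< (λ _ → fallingFactorial N m) (suc N)
    ≡⟨ ∑<-const (fallingFactorial N m) (suc N) ⟩
  fallingFactorial (suc N) (suc m) ∎
  where
  open ≡-Reasoning
  first-letter : ∀ a → a ≤ N → countWords (λ w → distinct (suc a ∷ w)) (suc N) m ≡ fallingFactorial N m
  first-letter a a≤N = begin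
    countWords (λ w → notIn (suc a) w ∧ distinct w) (suc N) m
      ≡⟨ countWords-cong (suc N) m (λ w _ → cong (notIn (suc a) w ∧_) (∧-identityʳ (distinct w))) ⟨
    countWords (λ w → notIn (suc a) w ∧ (distinct w ∧ true)) (suc N) m
      ≡⟨ countWords-relabel a N a≤N m (λ _ → true) ⟩
    countWords (λ σ → distinct σ ∧ true) N m
      ≡⟨ countWords-cong N m (λ σ _ → ∧-identityʳ (distinct σ)) ⟩
    countWords distinct N m
      ≡⟨ countWords-distinct N m ⟩
    fallingFactorial N m ∎

countWords-pigeonhole : ∀ N Q → countWords (λ w → distinct w ∧ Q w) N (suc N) ≡ 0
countWords-pigeonhole N Q = n≤0⇒n≡0 (begin
  countWords (λ w → distinct w ∧ Q w) N (suc N) ≤⟨ count-∧-≤ distinct Q (words N (suc N)) ⟩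
  countWords distinct N (suc N)                 ≡⟨ countWords-distinct N (suc N) ⟩
  fallingFactorial N (suc N)                    ≡⟨ fallingFactorial-excess N ⟩
  0                                             ∎)
  where open ≤-Reasoning

allᵇ-++ : ∀ (p : ℕ → Bool) u v → allᵇ p (u ++ v) ≡ allᵇ p u ∧ allᵇ p v
allᵇ-++ p []      v = refl
allᵇ-++ p (x ∷ u) v = trans (cong (p x ∧_) (allᵇ-++ p u v)) (sym (∧-assoc (p x) _ _))

allᵇ-reverse : ∀ (p : ℕ → Bool) u → allᵇ p (reverse u) ≡ allᵇ p u
allᵇ-reverse p []      = refl
allᵇ-reverse p (x ∷ u) = begin
  allᵇ p (reverse (x ∷ u))          ≡⟨ cong (allᵇ p) (unfold-reverse x u) ⟩
  allᵇ p (reverse u ++ [ x ])       ≡⟨ allᵇ-++ p (reverse u) [ x ] ⟩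
  allᵇ p (reverse u) ∧ (p x ∧ true) ≡⟨ cong₂ _∧_ (allᵇ-reverse p u) (∧-identityʳ (p x)) ⟩
  allᵇ p u ∧ p x                    ≡⟨ ∧-comm (allᵇ p u) (p x) ⟩
  allᵇ p (x ∷ u)                    ∎
  where open ≡-Reasoning

allᵇ-take : ∀ (p : ℕ → Bool) n l → allᵇ p l ≡ true → allᵇ p (take n l) ≡ true
allᵇ-take p n l all = ∧-conicalˡ _ (allᵇ p (drop n l))
  (trans (sym (allᵇ-++ p (take n l) (drop n l))) (trans (cong (allᵇ p) (take++drop≡id n l)) all))

allᵇ-drop : ∀ (p : ℕ → Bool) n l → allᵇ p l ≡ true → allᵇ p (drop n l) ≡ true
allᵇ-drop p n l all = ∧-conicalʳ (allᵇ p (take n l)) _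
  (trans (sym (allᵇ-++ p (take n l) (drop n l))) (trans (cong (allᵇ p) (take++drop≡id n l)) all))

take-length-++ : ∀ {A : Set} (u v : List A) → take (length u) (u ++ v) ≡ u
take-length-++ []      v = refl
take-length-++ (x ∷ u) v = cong (x ∷_) (take-length-++ u v)

drop-length-++ : ∀ {A : Set} (u v : List A) → drop (length u) (u ++ v) ≡ v
drop-length-++ []      v = refl
drop-length-++ (x ∷ u) v = drop-length-++ u v

reverse-middle : ∀ {A : Set} (u : List A) m v → reverse (u ++ m ∷ v) ≡ reverse v ++ m ∷ reverse u
reverse-middle u m v = begin
  reverse (u ++ m ∷ v)              ≡⟨ reverse-++ u (m ∷ v) ⟩
  reverse (m ∷ v) ++ reverse u      ≡⟨ cong (_++ reverse u) (unfold-reverse m v) ⟩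
  (reverse v ++ [ m ]) ++ reverse u ≡⟨ ++-assoc (reverse v) [ m ] (reverse u) ⟩
  reverse v ++ m ∷ reverse u        ∎
  where open ≡-Reasoning

distinct-∷ʳ : ∀ u x → distinct (u ++ [ x ]) ≡ notIn x u ∧ distinct u
distinct-∷ʳ []      x = refl
distinct-∷ʳ (y ∷ u) x = begin
  notIn y (u ++ [ x ]) ∧ distinct (u ++ [ x ])
    ≡⟨ cong₂ _∧_ (allᵇ-++ _ u [ x ]) (distinct-∷ʳ u x) ⟩
  (notIn y u ∧ (not (y ≡ᵇ x) ∧ true)) ∧ (notIn x u ∧ distinct u)
    ≡⟨ cong (λ b → (notIn y u ∧ b) ∧ (notIn x u ∧ distinct u)) (trans (∧-identityʳ _) (cong not (≡ᵇ-comm y x))) ⟩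
  (notIn y u ∧ not (x ≡ᵇ y)) ∧ (notIn x u ∧ distinct u)
    ≡⟨ cong (_∧ (notIn x u ∧ distinct u)) (∧-comm (notIn y u) _) ⟩
  (not (x ≡ᵇ y) ∧ notIn y u) ∧ (notIn x u ∧ distinct u)
    ≡⟨ ∧-interchange (not (x ≡ᵇ y)) (notIn y u) (notIn x u) (distinct u) ⟩
  notIn x (y ∷ u) ∧ distinct (y ∷ u) ∎
  where open ≡-Reasoning

distinct-reverse : ∀ w → distinct (reverse w) ≡ distinct w
distinct-reverse []      = refl
distinct-reverse (y ∷ w) = begin
  distinct (reverse (y ∷ w))                 ≡⟨ cong distinct (unfold-reverse y w) ⟩
  distinct (reverse w ++ [ y ])              ≡⟨ distinct-∷ʳ (reverse w) y ⟩
  notIn y (reverse w) ∧ distinct (reverse w) ≡⟨ cong₂ _∧_ (allᵇ-reverse _ w) (distinct-reverse w) ⟩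
  distinct (y ∷ w)                           ∎
  where open ≡-Reasoning

notIn-middle : ∀ U x R → distinct (U ++ x ∷ R) ≡ true → notIn x U ≡ true × notIn x R ≡ true
notIn-middle []      x R dist = refl , ∧-conicalˡ (notIn x R) (distinct R) dist
notIn-middle (y ∷ U) x R dist with notIn-middle U x R (∧-conicalʳ (notIn y (U ++ x ∷ R)) _ dist)
... | x∉U , x∉R = cong₂ _∧_ (trans (cong not (≡ᵇ-comm x y)) y≢x) x∉U , x∉R
  where
  y∉U++xR : notIn y U ∧ (not (y ≡ᵇ x) ∧ notIn y R) ≡ true
  y∉U++xR = trans (sym (allᵇ-++ _ U (x ∷ R))) (∧-conicalˡ (notIn y (U ++ x ∷ R)) _ dist)
  y≢x : not (y ≡ᵇ x) ≡ true
  y≢x = ∧-conicalˡ (not (y ≡ᵇ x)) (notIn y R) (∧-conicalʳ (notIn y U) _ y∉U++xR)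

allᵇ-above-one : ∀ u → notIn 1 u ≡ true → All (0 <_) u → allᵇ (1 <ᵇ_) u ≡ true
allᵇ-above-one []                _   _         = refl
allᵇ-above-one (suc (suc z) ∷ u) 1∉u (_ ∷ pos) = allᵇ-above-one u 1∉u pos

oneAt : ℕ → List ℕ → Bool
oneAt p       []      = false
oneAt zero    (x ∷ w) = x ≡ᵇ 1
oneAt (suc p) (x ∷ w) = oneAt p w

oneAt-split : ∀ p w → oneAt p w ≡ true → Σ[ U ∈ List ℕ ] Σ[ R ∈ List ℕ ] (w ≡ U ++ 1 ∷ R × length U ≡ p)
oneAt-split zero    (suc zero ∷ w) _   = [] , w , refl , refl
oneAt-split (suc p) (x ∷ w)        one with oneAt-split p w one
... | U , R , refl , refl = x ∷ U , R , refl , refl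

oneAt-middle : ∀ U R → oneAt (length U) (U ++ 1 ∷ R) ≡ true
oneAt-middle []      R = refl
oneAt-middle (x ∷ U) R = oneAt-middle U R

oneAt-take : ∀ p k w → p < k → oneAt p w ≡ true → oneAt p (take k w) ≡ true
oneAt-take zero    (suc k) (x ∷ w) _         one = one
oneAt-take (suc p) (suc k) (x ∷ w) (s≤s p<k) one = oneAt-take p k w p<k one

oneAt-reverse⇒ : ∀ p q w → suc (p + q) ≡ length w → oneAt p (reverse w) ≡ true → oneAt q w ≡ true
oneAt-reverse⇒ p q w |w| one with oneAt-split p (reverse w) one
... | U , R , w≡ , refl =
  subst (λ v → oneAt q v ≡ true) w′≡w (subst (λ i → oneAt i w′ ≡ true) |R|≡q (oneAt-middle (reverse R) (reverse U)))
  where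
  w′ : List ℕ
  w′ = reverse R ++ 1 ∷ reverse U
  w′≡w : w′ ≡ w
  w′≡w = trans (sym (reverse-middle U 1 R)) (trans (cong reverse (sym w≡)) (reverse-involutive w))
  |R|≡q : length (reverse R) ≡ q
  |R|≡q = suc-injective (+-cancelˡ-≡ (length U) _ _ (begin
    length U + suc (length (reverse R)) ≡⟨ cong (λ n → length U + suc n) (length-reverse R) ⟩
    length U + length (1 ∷ R)           ≡⟨ length-++ U ⟨
    length (U ++ 1 ∷ R)                 ≡⟨ cong length w≡ ⟨
    length (reverse w)                  ≡⟨ length-reverse w ⟩
    length w                            ≡⟨ |w| ⟨
    suc (length U + q)                  ≡⟨ +-suc (length U) q ⟨
    length U + suc q                    ∎))
    where open ≡-Reasoning

oneAt-reverse : ∀ p q w → suc (p + q) ≡ length w → oneAt p (reverse w) ≡ oneAt q w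
oneAt-reverse p q w |w| = ⇔→≡ {z = true} (mk⇔ (oneAt-reverse⇒ p q w |w|)
  (λ one → oneAt-reverse⇒ q p (reverse w)
    (trans (cong suc (+-comm q p)) (trans |w| (sym (length-reverse w))))
    (subst (λ v → oneAt q v ≡ true) (sym (reverse-involutive w)) one)))

oneAt-punchIn : ∀ a p σ → oneAt p (map (punchIn (suc (suc a))) σ) ≡ oneAt p σ
oneAt-punchIn a p       []      = refl
oneAt-punchIn a zero    (y ∷ σ) = punchIn-≡ᵇ (suc (suc a)) y 1
oneAt-punchIn a (suc p) (y ∷ σ) = oneAt-punchIn a p σ

notIn⇒¬oneAt : ∀ p w → notIn 1 w ≡ true → oneAt p w ≡ false
notIn⇒¬oneAt p       []                _   = refl
notIn⇒¬oneAt zero    (zero ∷ w)        _   = refl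
notIn⇒¬oneAt zero    (suc (suc x) ∷ w) _   = refl
notIn⇒¬oneAt (suc p) (x ∷ w)           1∉w = notIn⇒¬oneAt p w (∧-conicalʳ (not (1 ≡ᵇ x)) (notIn 1 w) 1∉w)

oneAt-partition : ∀ w M → distinct w ≡ true → length w ≤ M → ∑< (λ p → χ (oneAt p w)) M + χ (notIn 1 w) ≡ 1
oneAt-partition []                M       _    _         = cong (_+ 1) (∑<-zero _ M (λ _ _ → refl))
oneAt-partition (zero ∷ w)        (suc M) dist (s≤s |w|) = oneAt-partition w M (∧-conicalʳ (notIn 0 w) _ dist) |w|
oneAt-partition (suc (suc x) ∷ w) (suc M) dist (s≤s |w|) = oneAt-partition w M (∧-conicalʳ (notIn (suc (suc x)) w) _ dist) |w|
oneAt-partition (suc zero ∷ w)    (suc M) dist _         =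
  cong (λ n → suc (n + 0)) (∑<-zero _ M (λ p _ → cong χ (notIn⇒¬oneAt p w (∧-conicalˡ (notIn 1 w) _ dist))))

oneAt⇒¬allᵇ-above : ∀ p u m → 0 < m → oneAt p u ≡ true → allᵇ (m <ᵇ_) u ≡ false
oneAt⇒¬allᵇ-above zero    (suc zero ∷ u) (suc m) _   _   = refl
oneAt⇒¬allᵇ-above (suc p) (x ∷ u)        m       0<m one =
  trans (cong ((m <ᵇ x) ∧_) (oneAt⇒¬allᵇ-above p u m 0<m one)) (∧-zeroʳ (m <ᵇ x))

-- Occurrences of the pattern

data Occurrence (k ℓ : ℕ) : List ℕ → Set where
  occurrence : ∀ x u m v y → length u ≡ k → length v ≡ ℓ →
               allᵇ (m <ᵇ_) u ≡ true → allᵇ (m <ᵇ_) v ≡ true →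
               Occurrence k ℓ (x ++ u ++ m ∷ v ++ y)

-- The body of occursHere as a function of the list drop k w that its with-clause inspects.
occursHere′ : ℕ → ℕ → List ℕ → List ℕ → Bool
occursHere′ k ℓ w []         = false
occursHere′ k ℓ w (m ∷ rest) =
  (suc (k + ℓ) ≤ᵇ length w) ∧ allᵇ (m <ᵇ_) (take k w) ∧ allᵇ (m <ᵇ_) (take ℓ rest)

occursHere≡occursHere′ : ∀ k ℓ w → occursHere k ℓ w ≡ occursHere′ k ℓ w (drop k w)
occursHere≡occursHere′ k ℓ w with drop k w
... | []       = refl
... | m ∷ rest = refl

length-window : ∀ (u : List ℕ) m v y → length u + length v < length (u ++ m ∷ v ++ y)
length-window u m v y = begin-strict
  length u + length v                    <⟨ s≤s (+-monoʳ-≤ (length u) (m≤m+n (length v) (length y))) ⟩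
  suc (length u + (length v + length y)) ≡⟨ +-suc (length u) _ ⟨
  length u + suc (length v + length y)   ≡⟨ cong (λ n → length u + suc n) (length-++ v) ⟨
  length u + length (m ∷ v ++ y)         ≡⟨ length-++ u ⟨
  length (u ++ m ∷ v ++ y)               ∎
  where open ≤-Reasoning

occursHere-intro : ∀ u m v y → allᵇ (m <ᵇ_) u ≡ true → allᵇ (m <ᵇ_) v ≡ true →
                   occursHere (length u) (length v) (u ++ m ∷ v ++ y) ≡ true
occursHere-intro u m v y u>m v>m
  rewrite occursHere≡occursHere′ (length u) (length v) (u ++ m ∷ v ++ y)
        | drop-length-++ u (m ∷ v ++ y) | take-length-++ u (m ∷ v ++ y) | take-length-++ v y
        | u>m | v>m | T-≡ .Equivalence.to (<⇒<ᵇ (length-window u m v y)) = refl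

occursHere⇒contains : ∀ k ℓ w → occursHere k ℓ w ≡ true → contains k ℓ w ≡ true
occursHere⇒contains zero    ℓ []      ()
occursHere⇒contains (suc k) ℓ []      ()
occursHere⇒contains k       ℓ (x ∷ w) here = cong (_∨ contains k ℓ w) here

Occurrence⇒contains : ∀ {k ℓ w} → Occurrence k ℓ w → contains k ℓ w ≡ true
Occurrence⇒contains {k} {ℓ} (occurrence x u m v y refl refl u>m v>m) = go x
  where
  go : ∀ x → contains k ℓ (x ++ u ++ m ∷ v ++ y) ≡ true
  go []      = occursHere⇒contains k ℓ _ (occursHere-intro u m v y u>m v>m)
  go (z ∷ x) = trans (cong (occursHere k ℓ (z ∷ x ++ u ++ m ∷ v ++ y) ∨_) (go x)) (∨-zeroʳ _)

occursHere⇒Occurrence : ∀ k ℓ w → occursHere k ℓ w ≡ true → Occurrence k ℓ w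
occursHere⇒Occurrence k ℓ w here = split (drop k w) refl (trans (sym (occursHere≡occursHere′ k ℓ w)) here)
  where
  split : ∀ d → drop k w ≡ d → occursHere′ k ℓ w d ≡ true → Occurrence k ℓ w
  split (m ∷ rest) drop≡ here′ = subst (Occurrence k ℓ) w≡
    (occurrence [] (take k w) m (take ℓ rest) (drop ℓ rest) length-u length-v
      (∧-conicalˡ u>m v>m u>m∧v>m) (∧-conicalʳ u>m v>m u>m∧v>m))
    where
    long u>m v>m : Bool
    long = suc (k + ℓ) ≤ᵇ length w
    u>m  = allᵇ (m <ᵇ_) (take k w)
    v>m  = allᵇ (m <ᵇ_) (take ℓ rest)
    u>m∧v>m : u>m ∧ v>m ≡ true
    u>m∧v>m = ∧-conicalʳ long (u>m ∧ v>m) here′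
    k+ℓ<w : k + ℓ < length w
    k+ℓ<w = ≤ᵇ⇒≤ (suc (k + ℓ)) (length w) (T-≡ .Equivalence.from (∧-conicalˡ long (u>m ∧ v>m) here′))
    w≡ : take k w ++ m ∷ take ℓ rest ++ drop ℓ rest ≡ w
    w≡ = begin
      take k w ++ m ∷ take ℓ rest ++ drop ℓ rest ≡⟨ cong (λ r → take k w ++ m ∷ r) (take++drop≡id ℓ rest) ⟩
      take k w ++ m ∷ rest                       ≡⟨ cong (take k w ++_) drop≡ ⟨
      take k w ++ drop k w                       ≡⟨ take++drop≡id k w ⟩
      w                                          ∎
      where open ≡-Reasoning
    length-u : length (take k w) ≡ k
    length-u = trans (length-take k w) (m≤n⇒m⊓n≡m (≤-trans (m≤m+n k ℓ) (<⇒≤ k+ℓ<w)))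
    length-v : length (take ℓ rest) ≡ ℓ
    length-v = trans (length-take ℓ rest) (m≤n⇒m⊓n≡m (≤-pred (begin-strict
      ℓ                 ≡⟨ m+n∸m≡n k ℓ ⟨
      k + ℓ ∸ k         <⟨ ∸-monoˡ-< k+ℓ<w (m≤m+n k ℓ) ⟩
      length w ∸ k      ≡⟨ length-drop k w ⟨
      length (drop k w) ≡⟨ cong length drop≡ ⟩
      suc (length rest) ∎)))
      where open ≤-Reasoning

contains⇒Occurrence : ∀ k ℓ w → contains k ℓ w ≡ true → Occurrence k ℓ w
contains⇒Occurrence k ℓ (z ∷ w) found with occursHere k ℓ (z ∷ w) in here
... | true  = occursHere⇒Occurrence k ℓ (z ∷ w) here
... | false with contains⇒Occurrence k ℓ w found
...   | occurrence x u m v y |u| |v| u>m v>m = occurrence (z ∷ x) u m v y |u| |v| u>m v>m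

Occurrence-length : ∀ {k ℓ w} → Occurrence k ℓ w → k + ℓ < length w
Occurrence-length (occurrence x u m v y refl refl _ _) = begin-strict
  length u + length v                 <⟨ length-window u m v y ⟩
  length (u ++ m ∷ v ++ y)            ≤⟨ m≤n+m _ (length x) ⟩
  length x + length (u ++ m ∷ v ++ y) ≡⟨ length-++ x ⟨
  length (x ++ u ++ m ∷ v ++ y)       ∎
  where open ≤-Reasoning

contains-short : ∀ k ℓ w → length w ≤ k + ℓ → contains k ℓ w ≡ false
contains-short k ℓ w short with contains k ℓ w in found
... | false = refl
... | true  = ⊥-elim (<⇒≱ (Occurrence-length (contains⇒Occurrence k ℓ w found)) short)

reverse-window : ∀ {A : Set} (x u : List A) m v y →
                 reverse (x ++ u ++ m ∷ v ++ y) ≡ reverse y ++ reverse v ++ m ∷ reverse u ++ reverse x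
reverse-window x u m v y = begin
  reverse (x ++ u ++ m ∷ v ++ y)                         ≡⟨ cong reverse (++-assoc x u (m ∷ v ++ y)) ⟨
  reverse ((x ++ u) ++ m ∷ v ++ y)                       ≡⟨ reverse-middle (x ++ u) m (v ++ y) ⟩
  reverse (v ++ y) ++ m ∷ reverse (x ++ u)               ≡⟨ cong₂ (λ a b → a ++ m ∷ b) (reverse-++ v y) (reverse-++ x u) ⟩
  (reverse y ++ reverse v) ++ m ∷ reverse u ++ reverse x ≡⟨ ++-assoc (reverse y) (reverse v) _ ⟩
  reverse y ++ reverse v ++ m ∷ reverse u ++ reverse x   ∎
  where open ≡-Reasoning

Occurrence-reverse : ∀ {k ℓ w} → Occurrence k ℓ w → Occurrence ℓ k (reverse w)
Occurrence-reverse (occurrence x u m v y |u| |v| u>m v>m) = subst (Occurrence _ _) (sym (reverse-window x u m v y))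
  (occurrence (reverse y) (reverse v) m (reverse u) (reverse x)
    (trans (length-reverse v) |v|) (trans (length-reverse u) |u|)
    (trans (allᵇ-reverse _ v) v>m) (trans (allᵇ-reverse _ u) u>m))

contains-reverse : ∀ k ℓ w → contains k ℓ (reverse w) ≡ contains ℓ k w
contains-reverse k ℓ w = ⇔→≡ {z = true} (mk⇔
  (λ found → Occurrence⇒contains (subst (Occurrence ℓ k) (reverse-involutive w)
               (Occurrence-reverse (contains⇒Occurrence k ℓ (reverse w) found))))
  (λ found → Occurrence⇒contains (Occurrence-reverse (contains⇒Occurrence ℓ k w found))))

module _ (f : ℕ → ℕ) (f-<ᵇ : ∀ x y → (f x <ᵇ f y) ≡ (x <ᵇ y)) where

  allᵇ-map-above : ∀ m u → allᵇ (f m <ᵇ_) (map f u) ≡ allᵇ (m <ᵇ_) u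
  allᵇ-map-above m []      = refl
  allᵇ-map-above m (y ∷ u) = cong₂ _∧_ (f-<ᵇ m y) (allᵇ-map-above m u)

  occursHere′-map : ∀ k ℓ w d → occursHere′ k ℓ (map f w) (map f d) ≡ occursHere′ k ℓ w d
  occursHere′-map k ℓ w []         = refl
  occursHere′-map k ℓ w (m ∷ rest)
    rewrite length-map f w | take-map {f = f} k w | take-map {f = f} ℓ rest
          | allᵇ-map-above m (take k w) | allᵇ-map-above m (take ℓ rest) = refl

  occursHere-map : ∀ k ℓ w → occursHere k ℓ (map f w) ≡ occursHere k ℓ w
  occursHere-map k ℓ w = begin
    occursHere k ℓ (map f w)                     ≡⟨ occursHere≡occursHere′ k ℓ (map f w) ⟩
    occursHere′ k ℓ (map f w) (drop k (map f w)) ≡⟨ cong (occursHere′ k ℓ (map f w)) (drop-map {f = f} k w) ⟩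
    occursHere′ k ℓ (map f w) (map f (drop k w)) ≡⟨ occursHere′-map k ℓ w (drop k w) ⟩
    occursHere′ k ℓ w (drop k w)                 ≡⟨ occursHere≡occursHere′ k ℓ w ⟨
    occursHere k ℓ w                             ∎
    where open ≡-Reasoning

  contains-map : ∀ k ℓ w → contains k ℓ (map f w) ≡ contains k ℓ w
  contains-map k ℓ []      = refl
  contains-map k ℓ (x ∷ w) = cong₂ _∨_ (occursHere-map k ℓ (x ∷ w)) (contains-map k ℓ w)

avoids-punchIn : ∀ a k ℓ σ → avoids k ℓ (map (punchIn a) σ) ≡ avoids k ℓ σ
avoids-punchIn a k ℓ σ = cong not (contains-map (punchIn a) (punchIn-<ᵇ a) k ℓ σ)

occursHere-oneAt< : ∀ k ℓ p w → All (0 <_) w → oneAt p w ≡ true → p < k → occursHere k ℓ w ≡ false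
occursHere-oneAt< k ℓ p w pos one p<k = trans (occursHere≡occursHere′ k ℓ w) (refute (drop k w) refl)
  where
  refute : ∀ d → drop k w ≡ d → occursHere′ k ℓ w d ≡ false
  refute []         _     = refl
  refute (m ∷ rest) drop≡ with subst (All (0 <_)) drop≡ (drop⁺ k pos)
  ... | 0<m ∷ _ = trans
    (cong (λ b → (suc (k + ℓ) ≤ᵇ length w) ∧ b ∧ allᵇ (m <ᵇ_) (take ℓ rest))
          (oneAt⇒¬allᵇ-above p (take k w) m 0<m (oneAt-take p k w p<k one)))
    (∧-zeroʳ (suc (k + ℓ) ≤ᵇ length w))

avoids-∷-oneAt< : ∀ k ℓ p x τ → All (0 <_) (x ∷ τ) → oneAt p (x ∷ τ) ≡ true → p < k →
                  avoids k ℓ (x ∷ τ) ≡ avoids k ℓ τ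
avoids-∷-oneAt< k ℓ p x τ pos one p<k =
  cong (λ b → not (b ∨ contains k ℓ τ)) (occursHere-oneAt< k ℓ p (x ∷ τ) pos one p<k)

contains-oneAt : ∀ k ℓ p w → distinct w ≡ true → All (0 <_) w → oneAt p w ≡ true →
                 k ≤ p → p + ℓ < length w → contains k ℓ w ≡ true
contains-oneAt k ℓ p w dist pos one k≤p room with oneAt-split p w one
... | U , R , refl , refl with notIn-middle U 1 R dist
...   | 1∉U , 1∉R = Occurrence⇒contains (subst (Occurrence k ℓ) w≡
        (occurrence (take j U) (drop j U) 1 (take ℓ R) (drop ℓ R) |u| |v|
          (allᵇ-drop _ j U (allᵇ-above-one U 1∉U (++⁻ˡ U pos)))
          (allᵇ-take _ ℓ R (allᵇ-above-one R 1∉R (tail (++⁻ʳ U pos))))))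
  where
  j : ℕ
  j = length U ∸ k
  w≡ : take j U ++ drop j U ++ 1 ∷ take ℓ R ++ drop ℓ R ≡ U ++ 1 ∷ R
  w≡ = begin
    take j U ++ drop j U ++ 1 ∷ take ℓ R ++ drop ℓ R ≡⟨ cong (λ r → take j U ++ drop j U ++ 1 ∷ r) (take++drop≡id ℓ R) ⟩
    take j U ++ drop j U ++ 1 ∷ R                    ≡⟨ ++-assoc (take j U) (drop j U) (1 ∷ R) ⟨
    (take j U ++ drop j U) ++ 1 ∷ R                  ≡⟨ cong (_++ 1 ∷ R) (take++drop≡id j U) ⟩
    U ++ 1 ∷ R                                       ∎
    where open ≡-Reasoning
  |u| : length (drop j U) ≡ k
  |u| = trans (length-drop j U) (m∸[m∸n]≡n k≤p)
  |v| : length (take ℓ R) ≡ ℓ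
  |v| = trans (length-take ℓ R) (m≤n⇒m⊓n≡m (≤-pred (+-cancelˡ-< (length U) ℓ (suc (length R))
          (subst (length U + ℓ <_) (length-++ U) room))))

-- Avoiders by the position of the letter 1

A≡countWords : ∀ k ℓ n → A k ℓ n ≡ countWords (λ w → distinct w ∧ avoids k ℓ w) n n
A≡countWords k ℓ n = count-filterᵇ (avoids k ℓ) distinct (words n n)

∧-congˡ-guarded : ∀ {x x′} y → (y ≡ true → x ≡ x′) → x ∧ y ≡ x′ ∧ y
∧-congˡ-guarded {x} {x′} true  x≡x′ = cong (_∧ true) (x≡x′ refl)
∧-congˡ-guarded {x} {x′} false _    = trans (∧-zeroʳ x) (sym (∧-zeroʳ x′))

avoidersWithOneAt : ℕ → ℕ → ℕ → ℕ → ℕ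
avoidersWithOneAt k ℓ n p = countWords (λ w → distinct w ∧ (avoids k ℓ w ∧ oneAt p w)) (suc n) (suc n)

avoidersWithOneAt-first : ∀ k ℓ n → 0 < k → avoidersWithOneAt k ℓ n 0 ≡ A k ℓ n
avoidersWithOneAt-first k ℓ n 0<k = begin
  avoidersWithOneAt k ℓ n 0            ≡⟨ countWords-∷ _ (suc n) n ⟩
  first 0 + ∑< (λ a → first (suc a)) n ≡⟨ cong₂ _+_ one-first (∑<-zero _ n (λ a _ → other-first a)) ⟩
  A k ℓ n + 0                          ≡⟨ +-identityʳ _ ⟩
  A k ℓ n                              ∎
  where
  open ≡-Reasoning
  first : ℕ → ℕ
  first a = countWords (λ w → distinct (suc a ∷ w) ∧ (avoids k ℓ (suc a ∷ w) ∧ oneAt 0 (suc a ∷ w))) (suc n) n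
  other-first : ∀ a → first (suc a) ≡ 0
  other-first a = countWords-none _ (suc n) n (λ w _ →
    trans (cong (distinct (suc (suc a) ∷ w) ∧_) (∧-zeroʳ (avoids k ℓ (suc (suc a) ∷ w)))) (∧-zeroʳ (distinct (suc (suc a) ∷ w))))
  reassociate : ∀ w → (notIn 1 w ∧ distinct w) ∧ (avoids k ℓ (1 ∷ w) ∧ true) ≡ notIn 1 w ∧ (distinct w ∧ avoids k ℓ (1 ∷ w))
  reassociate w = trans (cong ((notIn 1 w ∧ distinct w) ∧_) (∧-identityʳ _)) (∧-assoc (notIn 1 w) _ _)
  drop-one : ∀ σ → All (0 <_) σ → avoids k ℓ (1 ∷ map (punchIn 1) σ) ≡ avoids k ℓ σ
  drop-one σ pos = trans (avoids-∷-oneAt< k ℓ 0 1 (map (punchIn 1) σ) (s≤s z≤n ∷ punchIn-positive 1 σ pos) refl 0<k)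
                         (avoids-punchIn 1 k ℓ σ)
  one-first : first 0 ≡ A k ℓ n
  one-first = begin
    first 0
      ≡⟨ countWords-cong (suc n) n (λ w _ → reassociate w) ⟩
    countWords (λ w → notIn 1 w ∧ (distinct w ∧ avoids k ℓ (1 ∷ w))) (suc n) n
      ≡⟨ countWords-relabel 0 n z≤n n (λ w → avoids k ℓ (1 ∷ w)) ⟩
    countWords (λ σ → distinct σ ∧ avoids k ℓ (1 ∷ map (punchIn 1) σ)) n n
      ≡⟨ countWords-cong n n (λ σ (_ , pos) → cong (distinct σ ∧_) (drop-one σ pos)) ⟩
    countWords (λ σ → distinct σ ∧ avoids k ℓ σ) n n
      ≡⟨ A≡countWords k ℓ n ⟨
    A k ℓ n ∎

avoidersWithOneAt-suc : ∀ k ℓ n p → suc p < k → avoidersWithOneAt k ℓ (suc n) (suc p) ≡ suc n * avoidersWithOneAt k ℓ n p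
avoidersWithOneAt-suc k ℓ n p 1+p<k = begin
  avoidersWithOneAt k ℓ (suc n) (suc p)
    ≡⟨ countWords-∷ _ (suc (suc n)) (suc n) ⟩
  first 0 + ∑< (λ a → first (suc a)) (suc n)
    ≡⟨ cong₂ _+_ one-first (∑<-cong (suc n) (λ a a<1+n → other-first a (≤-pred a<1+n))) ⟩
  ∑< (λ _ → avoidersWithOneAt k ℓ n p) (suc n)
    ≡⟨ ∑<-const _ (suc n) ⟩
  suc n * avoidersWithOneAt k ℓ n p ∎
  where
  open ≡-Reasoning
  first : ℕ → ℕ
  first a = countWords (λ w → distinct (suc a ∷ w) ∧ (avoids k ℓ (suc a ∷ w) ∧ oneAt p w)) (suc (suc n)) (suc n)
  one-first : first 0 ≡ 0
  one-first = countWords-none _ (suc (suc n)) (suc n) (λ w _ → one-then-none w)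
    where
    one-then-none : ∀ w → (notIn 1 w ∧ distinct w) ∧ (avoids k ℓ (1 ∷ w) ∧ oneAt p w) ≡ false
    one-then-none w with notIn 1 w in 1∉w
    ... | false = refl
    ... | true  rewrite notIn⇒¬oneAt p w 1∉w =
      trans (cong (distinct w ∧_) (∧-zeroʳ (avoids k ℓ (1 ∷ w)))) (∧-zeroʳ (distinct w))
  other-first : ∀ a → a ≤ n → first (suc a) ≡ avoidersWithOneAt k ℓ n p
  other-first a a≤n = begin
    first (suc a)
      ≡⟨ countWords-cong (suc (suc n)) (suc n) (λ w _ → ∧-assoc (notIn b w) (distinct w) _) ⟩
    countWords (λ w → notIn b w ∧ (distinct w ∧ (avoids k ℓ (b ∷ w) ∧ oneAt p w))) (suc (suc n)) (suc n)
      ≡⟨ countWords-relabel (suc a) (suc n) (s≤s a≤n) (suc n) (λ w → avoids k ℓ (b ∷ w) ∧ oneAt p w) ⟩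
    countWords (λ σ → distinct σ ∧ (avoids k ℓ (b ∷ map (punchIn b) σ) ∧ oneAt p (map (punchIn b) σ))) (suc n) (suc n)
      ≡⟨ countWords-cong (suc n) (suc n) (λ σ (_ , pos) → cong (distinct σ ∧_) (drop-first σ pos)) ⟩
    avoidersWithOneAt k ℓ n p ∎
    where
    b : ℕ
    b = suc (suc a)
    drop-first : ∀ σ → All (0 <_) σ →
                 avoids k ℓ (b ∷ map (punchIn b) σ) ∧ oneAt p (map (punchIn b) σ) ≡ avoids k ℓ σ ∧ oneAt p σ
    drop-first σ pos rewrite oneAt-punchIn a p σ = ∧-congˡ-guarded (oneAt p σ) (λ one →
      trans (avoids-∷-oneAt< k ℓ (suc p) b (map (punchIn b) σ) (s≤s z≤n ∷ punchIn-positive b σ pos)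
                             (trans (oneAt-punchIn a p σ) one) 1+p<k)
            (avoids-punchIn b k ℓ σ))

avoidersWithOneAt-prefix : ∀ k ℓ n p → p < k → avoidersWithOneAt k ℓ n p ≡ fallingFactorial n p * A k ℓ (n ∸ p)
avoidersWithOneAt-prefix k ℓ n       zero    0<k   = trans (avoidersWithOneAt-first k ℓ n 0<k) (sym (*-identityˡ _))
avoidersWithOneAt-prefix k ℓ zero    (suc p) _     = countWords-none _ 1 1 single
  where
  single : ∀ w → IsWord 1 w → distinct w ∧ (avoids k ℓ w ∧ oneAt (suc p) w) ≡ false
  single (x ∷ []) _ = trans (cong (distinct (x ∷ []) ∧_) (∧-zeroʳ (avoids k ℓ (x ∷ [])))) (∧-zeroʳ (distinct (x ∷ [])))
avoidersWithOneAt-prefix k ℓ (suc n) (suc p) 1+p<k = begin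
  avoidersWithOneAt k ℓ (suc n) (suc p)
    ≡⟨ avoidersWithOneAt-suc k ℓ n p 1+p<k ⟩
  suc n * avoidersWithOneAt k ℓ n p
    ≡⟨ cong (suc n *_) (avoidersWithOneAt-prefix k ℓ n p (<-trans (n<1+n p) 1+p<k)) ⟩
  suc n * (fallingFactorial n p * A k ℓ (n ∸ p))
    ≡⟨ *-assoc (suc n) (fallingFactorial n p) _ ⟨
  fallingFactorial (suc n) (suc p) * A k ℓ (suc n ∸ suc p) ∎
  where open ≡-Reasoning

avoidersWithOneAt-reverse : ∀ k ℓ n p → p ≤ n → avoidersWithOneAt k ℓ n p ≡ avoidersWithOneAt ℓ k n (n ∸ p)
avoidersWithOneAt-reverse k ℓ n p p≤n = begin
  avoidersWithOneAt k ℓ n p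
    ≡⟨ countWords-cong (suc n) (suc n) (λ w (|w| , _) → sym (reversed w |w|)) ⟩
  countWords (λ w → P (reverse w)) (suc n) (suc n)
    ≡⟨ countWords-reverse P (suc n) (suc n) ⟩
  avoidersWithOneAt ℓ k n (n ∸ p) ∎
  where
  open ≡-Reasoning
  P : List ℕ → Bool
  P w = distinct w ∧ (avoids ℓ k w ∧ oneAt (n ∸ p) w)
  reversed : ∀ w → length w ≡ suc n → P (reverse w) ≡ distinct w ∧ (avoids k ℓ w ∧ oneAt p w)
  reversed w |w|
    rewrite distinct-reverse w | contains-reverse ℓ k w
          | oneAt-reverse (n ∸ p) p w (trans (cong suc (m∸n+n≡m p≤n)) (sym |w|)) = refl

A-reverse : ∀ k ℓ m → A k ℓ m ≡ A ℓ k m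
A-reverse k ℓ m = begin
  A k ℓ m
    ≡⟨ A≡countWords k ℓ m ⟩
  countWords (λ w → distinct w ∧ avoids k ℓ w) m m
    ≡⟨ countWords-cong m m (λ w _ → sym (cong₂ (λ d c → d ∧ not c) (distinct-reverse w) (contains-reverse ℓ k w))) ⟩
  countWords (λ w → distinct (reverse w) ∧ avoids ℓ k (reverse w)) m m
    ≡⟨ countWords-reverse (λ w → distinct w ∧ avoids ℓ k w) m m ⟩
  countWords (λ w → distinct w ∧ avoids ℓ k w) m m
    ≡⟨ A≡countWords ℓ k m ⟨
  A ℓ k m ∎
  where open ≡-Reasoning

avoidersWithOneAt-suffix : ∀ k ℓ n p → p ≤ n → n ∸ p < ℓ →
                           avoidersWithOneAt k ℓ n p ≡ fallingFactorial n (n ∸ p) * A k ℓ p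
avoidersWithOneAt-suffix k ℓ n p p≤n n∸p<ℓ = begin
  avoidersWithOneAt k ℓ n p                        ≡⟨ avoidersWithOneAt-reverse k ℓ n p p≤n ⟩
  avoidersWithOneAt ℓ k n (n ∸ p)                  ≡⟨ avoidersWithOneAt-prefix ℓ k n (n ∸ p) n∸p<ℓ ⟩
  fallingFactorial n (n ∸ p) * A ℓ k (n ∸ (n ∸ p)) ≡⟨ cong (λ i → fallingFactorial n (n ∸ p) * A ℓ k i) (m∸[m∸n]≡n p≤n) ⟩
  fallingFactorial n (n ∸ p) * A ℓ k p             ≡⟨ cong (fallingFactorial n (n ∸ p) *_) (A-reverse ℓ k p) ⟩
  fallingFactorial n (n ∸ p) * A k ℓ p             ∎
  where open ≡-Reasoning

avoidersWithOneAt-middle : ∀ k ℓ n p → k ≤ p → p + ℓ ≤ n → avoidersWithOneAt k ℓ n p ≡ 0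
avoidersWithOneAt-middle k ℓ n p k≤p p+ℓ≤n = countWords-none _ (suc n) (suc n) none
  where
  none : ∀ w → IsWord (suc n) w → distinct w ∧ (avoids k ℓ w ∧ oneAt p w) ≡ false
  none w (|w| , pos) with distinct w in dist | oneAt p w in one
  ... | false | _     = refl
  ... | true  | false = ∧-zeroʳ (avoids k ℓ w)
  ... | true  | true  rewrite contains-oneAt k ℓ p w dist pos one k≤p (subst (p + ℓ <_) (sym |w|) (s≤s p+ℓ≤n)) = refl

A-short : ∀ k ℓ m → m ≤ k + ℓ → A k ℓ m ≡ m !
A-short k ℓ m m≤k+ℓ = begin
  A k ℓ m                                          ≡⟨ A≡countWords k ℓ m ⟩
  countWords (λ w → distinct w ∧ avoids k ℓ w) m m ≡⟨ countWords-cong m m (λ w (|w| , _) → all-avoid w |w|) ⟩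
  countWords distinct m m                          ≡⟨ countWords-distinct m m ⟩
  fallingFactorial m m                             ≡⟨ fallingFactorial-diagonal m ⟩
  m !                                              ∎
  where
  open ≡-Reasoning
  all-avoid : ∀ w → length w ≡ m → distinct w ∧ avoids k ℓ w ≡ distinct w
  all-avoid w |w| = trans (cong (λ c → distinct w ∧ not c) (contains-short k ℓ w (subst (_≤ k + ℓ) (sym |w|) m≤k+ℓ)))
                          (∧-identityʳ (distinct w))

A-suc : ∀ k ℓ n → A k ℓ (suc n) ≡ ∑< (avoidersWithOneAt k ℓ n) (suc n)
A-suc k ℓ n = begin
  A k ℓ (suc n)
    ≡⟨ A≡countWords k ℓ (suc n) ⟩
  countWords (λ w → distinct w ∧ avoids k ℓ w) (suc n) (suc n)
    ≡⟨ count-split _ (λ p w → distinct w ∧ (avoids k ℓ w ∧ oneAt p w)) (λ w → notIn 1 w ∧ (distinct w ∧ avoids k ℓ w))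
                   (suc n) (words (suc n) (suc n)) (All.map (λ {w} → by-position w) (words-isWord (suc n) (suc n))) ⟩
  ∑< (avoidersWithOneAt k ℓ n) (suc n) + countWords (λ w → notIn 1 w ∧ (distinct w ∧ avoids k ℓ w)) (suc n) (suc n)
    ≡⟨ cong (_+_ (∑< (avoidersWithOneAt k ℓ n) (suc n)))
            (trans (countWords-relabel 0 n z≤n (suc n) (avoids k ℓ)) (countWords-pigeonhole n _)) ⟩
  ∑< (avoidersWithOneAt k ℓ n) (suc n) + 0
    ≡⟨ +-identityʳ _ ⟩
  ∑< (avoidersWithOneAt k ℓ n) (suc n) ∎
  where
  open ≡-Reasoning
  by-position : ∀ w → IsWord (suc n) w →
    χ (distinct w ∧ avoids k ℓ w)
      ≡ ∑< (λ p → χ (distinct w ∧ (avoids k ℓ w ∧ oneAt p w))) (suc n) + χ (notIn 1 w ∧ (distinct w ∧ avoids k ℓ w))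
  by-position w (|w| , _) with distinct w in dist | avoids k ℓ w
  ... | false | _     = sym (cong₂ _+_ (∑<-zero _ (suc n) (λ _ _ → refl)) (cong χ (∧-zeroʳ (notIn 1 w))))
  ... | true  | false = sym (cong₂ _+_ (∑<-zero _ (suc n) (λ _ _ → refl)) (cong χ (∧-zeroʳ (notIn 1 w))))
  ... | true  | true  = sym (trans (cong (λ b → ∑< (λ p → χ (oneAt p w)) (suc n) + χ b) (∧-identityʳ (notIn 1 w)))
                                   (oneAt-partition w (suc n) dist (≤-reflexive |w|)))

-- The recurrence

weight : ℕ → ℕ → ℕ → ℕ
weight k ℓ j = χ (j <ᵇ k) + χ (j <ᵇ ℓ)

bothSidesShort : ℕ → ℕ → ℕ → ℕ
bothSidesShort k ℓ n = ∑< (λ p → χ ((p <ᵇ k) ∧ (n ∸ p <ᵇ ℓ))) (suc n)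

fallingFactorial-!′ : ∀ n p → p ≤ n → fallingFactorial n (n ∸ p) * p ! ≡ n !
fallingFactorial-!′ n p p≤n =
  trans (cong (λ i → fallingFactorial n (n ∸ p) * i !) (sym (m∸[m∸n]≡n p≤n))) (fallingFactorial-! n (n ∸ p) (m∸n≤m n p))

avoidersWithOneAt-cases : ∀ k ℓ n p → p ≤ n →
  avoidersWithOneAt k ℓ n p + n ! * χ ((p <ᵇ k) ∧ (n ∸ p <ᵇ ℓ))
    ≡ χ (p <ᵇ k) * (fallingFactorial n p * A k ℓ (n ∸ p)) + χ (n ∸ p <ᵇ ℓ) * (fallingFactorial n (n ∸ p) * A k ℓ p)
avoidersWithOneAt-cases k ℓ n p p≤n with p <ᵇ k | <ᵇ-reflects-< p k | n ∸ p <ᵇ ℓ | <ᵇ-reflects-< (n ∸ p) ℓ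
... | true  | ofʸ p<k | true  | ofʸ n∸p<ℓ = begin
  avoidersWithOneAt k ℓ n p + n ! * 1
    ≡⟨ cong₂ _+_ (avoidersWithOneAt-prefix k ℓ n p p<k) (*-identityʳ (n !)) ⟩
  fallingFactorial n p * A k ℓ (n ∸ p) + n !
    ≡⟨ cong₂ _+_ (*-identityˡ _) (trans (*-identityˡ _) all-avoid) ⟨
  1 * (fallingFactorial n p * A k ℓ (n ∸ p)) + 1 * (fallingFactorial n (n ∸ p) * A k ℓ p) ∎
  where
  open ≡-Reasoning
  all-avoid : fallingFactorial n (n ∸ p) * A k ℓ p ≡ n !
  all-avoid = trans (cong (fallingFactorial n (n ∸ p) *_) (A-short k ℓ p (≤-trans (<⇒≤ p<k) (m≤m+n k ℓ))))
                    (fallingFactorial-!′ n p p≤n)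
... | true  | ofʸ p<k | false | _ =
  trans (trans (cong₂ _+_ (avoidersWithOneAt-prefix k ℓ n p p<k) (*-zeroʳ (n !))) (+-identityʳ _))
        (sym (trans (+-identityʳ _) (*-identityˡ _)))
... | false | _       | true  | ofʸ n∸p<ℓ =
  trans (trans (cong₂ _+_ (avoidersWithOneAt-suffix k ℓ n p p≤n n∸p<ℓ) (*-zeroʳ (n !))) (+-identityʳ _))
        (sym (*-identityˡ _))
... | false | ofⁿ p≮k | false | ofⁿ n∸p≮ℓ =
  cong₂ _+_ (avoidersWithOneAt-middle k ℓ n p (≮⇒≥ p≮k) p+ℓ≤n) (*-zeroʳ (n !))
  where
  p+ℓ≤n : p + ℓ ≤ n
  p+ℓ≤n = subst (p + ℓ ≤_) (m+[n∸m]≡n p≤n) (+-monoʳ-≤ p (≮⇒≥ n∸p≮ℓ))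

A-recurrence : ∀ k ℓ n → A k ℓ (suc n) + n ! * bothSidesShort k ℓ n
                         ≡ ∑< (λ j → weight k ℓ j * (fallingFactorial n j * A k ℓ (n ∸ j))) (suc n)
A-recurrence k ℓ n = begin
  A k ℓ (suc n) + n ! * bothSidesShort k ℓ n
    ≡⟨ cong₂ _+_ (sym (A-suc k ℓ n)) (∑<-*ˡ (n !) short-both (suc n)) ⟨
  ∑< (avoidersWithOneAt k ℓ n) (suc n) + ∑< (λ p → n ! * short-both p) (suc n)
    ≡⟨ ∑<-distrib (avoidersWithOneAt k ℓ n) (λ p → n ! * short-both p) (suc n) ⟨
  ∑< (λ p → avoidersWithOneAt k ℓ n p + n ! * χ ((p <ᵇ k) ∧ (n ∸ p <ᵇ ℓ))) (suc n)
    ≡⟨ ∑<-cong (suc n) (λ p p<1+n → avoidersWithOneAt-cases k ℓ n p (≤-pred p<1+n)) ⟩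
  ∑< (λ p → before p + after p) (suc n)
    ≡⟨ ∑<-distrib before after (suc n) ⟩
  ∑< before (suc n) + ∑< after (suc n)
    ≡⟨ cong (_+_ (∑< before (suc n))) (trans (∑<-reflect after n) (∑<-cong (suc n) after-reflected)) ⟩
  ∑< before (suc n) + ∑< after′ (suc n)
    ≡⟨ ∑<-distrib before after′ (suc n) ⟨
  ∑< (λ j → before j + after′ j) (suc n)
    ≡⟨ ∑<-cong (suc n) (λ j _ → *-distribʳ-+ (fallingFactorial n j * A k ℓ (n ∸ j)) (χ (j <ᵇ k)) (χ (j <ᵇ ℓ))) ⟨
  ∑< (λ j → weight k ℓ j * (fallingFactorial n j * A k ℓ (n ∸ j))) (suc n) ∎
  where
  open ≡-Reasoning
  short-both before after after′ : ℕ → ℕ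
  short-both p = χ ((p <ᵇ k) ∧ (n ∸ p <ᵇ ℓ))
  before p = χ (p <ᵇ k) * (fallingFactorial n p * A k ℓ (n ∸ p))
  after  p = χ (n ∸ p <ᵇ ℓ) * (fallingFactorial n (n ∸ p) * A k ℓ p)
  after′ j = χ (j <ᵇ ℓ) * (fallingFactorial n j * A k ℓ (n ∸ j))
  after-reflected : ∀ j → j < suc n → after (n ∸ j) ≡ after′ j
  after-reflected j j<1+n = cong (λ i → χ (i <ᵇ ℓ) * (fallingFactorial n i * A k ℓ (n ∸ j))) (m∸[m∸n]≡n (≤-pred j<1+n))

χ<ᵇ-+-∸ : ∀ m ℓ → χ (m <ᵇ ℓ) + (suc m ∸ ℓ) ≡ suc (m ∸ ℓ)
χ<ᵇ-+-∸ m       zero    = refl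
χ<ᵇ-+-∸ zero    (suc ℓ) = cong suc (0∸n≡0 ℓ)
χ<ᵇ-+-∸ (suc m) (suc ℓ) = χ<ᵇ-+-∸ m ℓ

bothSidesShort-closed : ∀ k ℓ n → bothSidesShort k ℓ n + (suc n ∸ k) + (suc n ∸ ℓ) ≡ suc n + (suc n ∸ (k + ℓ))
bothSidesShort-closed zero    ℓ       n       = cong (λ c → c + suc n + (suc n ∸ ℓ)) (∑<-zero _ (suc n) (λ _ _ → refl))
bothSidesShort-closed (suc k) zero    zero    rewrite 0∸n≡0 k | 0∸n≡0 (k + 0) = refl
bothSidesShort-closed (suc k) (suc ℓ) zero    rewrite 0∸n≡0 k | 0∸n≡0 ℓ | 0∸n≡0 (k + suc ℓ) = refl
bothSidesShort-closed (suc k) ℓ       (suc n) = begin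
  (x + c) + a + e                 ≡⟨ rearrange x c a e ⟩
  (c + a) + (x + e)               ≡⟨ cong (_+_ (c + a)) (χ<ᵇ-+-∸ (suc n) ℓ) ⟩
  (c + a) + suc b                 ≡⟨ +-suc (c + a) b ⟩
  suc (c + a + b)                 ≡⟨ cong suc (bothSidesShort-closed k ℓ n) ⟩
  suc (suc n + (suc n ∸ (k + ℓ))) ∎
  where
  open ≡-Reasoning
  x c a b e : ℕ
  x = χ (suc n <ᵇ ℓ)
  c = bothSidesShort k ℓ n
  a = suc n ∸ k
  b = suc n ∸ ℓ
  e = suc (suc n) ∸ ℓ
  rearrange : ∀ x c a e → (x + c) + a + e ≡ (c + a) + (x + e)
  rearrange = ℕ-Solver.solve-∀

fromℕ : ℕ → ℚ
fromℕ n = + n / 1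

toℚᵘ-/ : ∀ i m → toℚᵘ (i / suc m) ℚᵘ.≃ mkℚᵘ i m
toℚᵘ-/ i m = ℚ.toℚᵘ-fromℚᵘ (mkℚᵘ i m)

fromℕ-+ : ∀ a b → fromℕ (a + b) ≡ fromℕ a +ℚ fromℕ b
fromℕ-+ a b = ℚ.toℚᵘ-injective (begin
  toℚᵘ (fromℕ (a + b))               ≈⟨ toℚᵘ-/ (+ (a + b)) 0 ⟩
  mkℚᵘ (+ (a + b)) 0                 ≈⟨ *≡* (cong (ℤ._* + 1) (trans (ℤ.pos-+ a b) (lemma (+ a) (+ b)))) ⟩
  mkℚᵘ (+ a) 0 ℚᵘ.+ mkℚᵘ (+ b) 0     ≈⟨ ℚᵘ.+-cong (toℚᵘ-/ (+ a) 0) (toℚᵘ-/ (+ b) 0) ⟨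
  toℚᵘ (fromℕ a) ℚᵘ.+ toℚᵘ (fromℕ b) ≈⟨ ℚ.toℚᵘ-homo-+ (fromℕ a) (fromℕ b) ⟨
  toℚᵘ (fromℕ a +ℚ fromℕ b)          ∎)
  where
  open ℚᵘ.≃-Reasoning
  lemma : ∀ x y → x ℤ.+ y ≡ x ℤ.* + 1 ℤ.+ y ℤ.* + 1
  lemma = ℤ-Solver.solve-∀

fromℕ-* : ∀ a b → fromℕ (a * b) ≡ fromℕ a *ℚ fromℕ b
fromℕ-* a b = ℚ.toℚᵘ-injective (begin
  toℚᵘ (fromℕ (a * b))               ≈⟨ toℚᵘ-/ (+ (a * b)) 0 ⟩
  mkℚᵘ (+ (a * b)) 0                 ≈⟨ *≡* (cong (ℤ._* + 1) (ℤ.pos-* a b)) ⟩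
  mkℚᵘ (+ a) 0 ℚᵘ.* mkℚᵘ (+ b) 0     ≈⟨ ℚᵘ.*-cong (toℚᵘ-/ (+ a) 0) (toℚᵘ-/ (+ b) 0) ⟨
  toℚᵘ (fromℕ a) ℚᵘ.* toℚᵘ (fromℕ b) ≈⟨ ℚ.toℚᵘ-homo-* (fromℕ a) (fromℕ b) ⟨
  toℚᵘ (fromℕ a *ℚ fromℕ b)          ∎)
  where open ℚᵘ.≃-Reasoning

-- ℚᵘ computes the denominator of a product as m + 0 * suc m, which only +-identityʳ turns into m.
/-as-* : ∀ a m .{{_ : NonZero m}} → + a / m ≡ fromℕ a *ℚ (+ 1 / m)
/-as-* a (suc m) = ℚ.toℚᵘ-injective (begin
  toℚᵘ (+ a / suc m)
    ≈⟨ toℚᵘ-/ (+ a) m ⟩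
  mkℚᵘ (+ a) m
    ≈⟨ *≡* (subst (λ z → + a ℤ.* + suc z ≡ (+ a ℤ.* + 1) ℤ.* + suc m) (sym (+-identityʳ m)) (lemma (+ a) (+ suc m))) ⟩
  mkℚᵘ (+ a) 0 ℚᵘ.* mkℚᵘ (+ 1) m
    ≈⟨ ℚᵘ.*-cong (toℚᵘ-/ (+ a) 0) (toℚᵘ-/ (+ 1) m) ⟨
  toℚᵘ (fromℕ a) ℚᵘ.* toℚᵘ (+ 1 / suc m)
    ≈⟨ ℚ.toℚᵘ-homo-* (fromℕ a) (+ 1 / suc m) ⟨
  toℚᵘ (fromℕ a *ℚ (+ 1 / suc m)) ∎)
  where
  open ℚᵘ.≃-Reasoning
  lemma : ∀ x d → x ℤ.* d ≡ (x ℤ.* + 1) ℤ.* d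
  lemma = ℤ-Solver.solve-∀

fromℕ-*-1/ : ∀ m .{{_ : NonZero m}} → fromℕ m *ℚ (+ 1 / m) ≡ 1ℚ
fromℕ-*-1/ (suc m) = ℚ.toℚᵘ-injective (begin
  toℚᵘ (fromℕ (suc m) *ℚ (+ 1 / suc m))
    ≈⟨ ℚ.toℚᵘ-homo-* (fromℕ (suc m)) (+ 1 / suc m) ⟩
  toℚᵘ (fromℕ (suc m)) ℚᵘ.* toℚᵘ (+ 1 / suc m)
    ≈⟨ ℚᵘ.*-cong (toℚᵘ-/ (+ suc m) 0) (toℚᵘ-/ (+ 1) m) ⟩
  mkℚᵘ (+ suc m) 0 ℚᵘ.* mkℚᵘ (+ 1) m
    ≈⟨ *≡* (subst (λ z → (+ suc m ℤ.* + 1) ℤ.* + 1 ≡ + 1 ℤ.* + suc z) (sym (+-identityʳ m)) (lemma (+ suc m))) ⟩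
  mkℚᵘ (+ 1) 0
    ≈⟨ toℚᵘ-/ (+ 1) 0 ⟨
  toℚᵘ 1ℚ ∎)
  where
  open ℚᵘ.≃-Reasoning
  lemma : ∀ d → (d ℤ.* + 1) ℤ.* + 1 ≡ + 1 ℤ.* d
  lemma = ℤ-Solver.solve-∀

1/-rescale : ∀ a b c .{{_ : NonZero b}} .{{_ : NonZero c}} → a * b ≡ c → + 1 / b ≡ fromℕ a *ℚ (+ 1 / c)
1/-rescale a b c a*b≡c = begin
  + 1 / b
    ≡⟨ ℚ.*-identityʳ (+ 1 / b) ⟨
  + 1 / b *ℚ 1ℚ
    ≡⟨ cong (+ 1 / b *ℚ_) (fromℕ-*-1/ c) ⟨
  + 1 / b *ℚ (fromℕ c *ℚ (+ 1 / c))
    ≡⟨ cong (λ x → + 1 / b *ℚ (x *ℚ (+ 1 / c))) (trans (cong fromℕ (sym a*b≡c)) (fromℕ-* a b)) ⟩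
  + 1 / b *ℚ ((fromℕ a *ℚ fromℕ b) *ℚ (+ 1 / c))
    ≡⟨ solve 4 (λ ib a b ic → ib :* ((a :* b) :* ic) := (a :* ic) :* (b :* ib)) refl (+ 1 / b) (fromℕ a) (fromℕ b) (+ 1 / c) ⟩
  (fromℕ a *ℚ (+ 1 / c)) *ℚ (fromℕ b *ℚ (+ 1 / b))
    ≡⟨ cong ((fromℕ a *ℚ (+ 1 / c)) *ℚ_) (fromℕ-*-1/ b) ⟩
  (fromℕ a *ℚ (+ 1 / c)) *ℚ 1ℚ
    ≡⟨ ℚ.*-identityʳ _ ⟩
  fromℕ a *ℚ (+ 1 / c) ∎
  where
  open ≡-Reasoning
  open +-*-Solver using (solve; _:=_; _:*_)

∑<-*ʳ : ∀ f c n → ℚ∑.∑< (λ i → f i *ℚ c) n ≡ ℚ∑.∑< f n *ℚ c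
∑<-*ʳ f c zero    = sym (ℚ.*-zeroˡ c)
∑<-*ʳ f c (suc n) = trans (cong (f 0 *ℚ c +ℚ_) (∑<-*ʳ (λ i → f (suc i)) c n)) (sym (ℚ.*-distribʳ-+ c (f 0) _))

∑<-neg : ∀ f n → ℚ∑.∑< (λ i → ℚ.- f i) n ≡ ℚ.- ℚ∑.∑< f n
∑<-neg f zero    = refl
∑<-neg f (suc n) = trans (cong (ℚ.- f 0 +ℚ_) (∑<-neg (λ i → f (suc i)) n)) (sym (ℚ.neg-distrib-+ (f 0) _))

fromℕ-∑ : ∀ f n → fromℕ (∑< f n) ≡ ℚ∑.∑< (λ i → fromℕ (f i)) n
fromℕ-∑ f zero    = refl
fromℕ-∑ f (suc n) = trans (fromℕ-+ (f 0) _) (cong (fromℕ (f 0) +ℚ_) (fromℕ-∑ (λ i → f (suc i)) n))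

-- Formal power series

⊛-∑ : ∀ f g n → (f ⊛ g) n ≡ ℚ∑.∑< (λ i → f i *ℚ g (n ∸ i)) (suc n)
⊛-∑ f g n = ℚ∑.∑<-foldr (λ i → f i *ℚ g (n ∸ i)) (λ i → i) (suc n)

⊛-distribʳ-⊕ : ∀ f g h n → ((f ⊕ g) ⊛ h) n ≡ (f ⊛ h) n +ℚ (g ⊛ h) n
⊛-distribʳ-⊕ f g h n = begin
  ((f ⊕ g) ⊛ h) n
    ≡⟨ ⊛-∑ (f ⊕ g) h n ⟩
  ℚ∑.∑< (λ i → (f i +ℚ g i) *ℚ h (n ∸ i)) (suc n)
    ≡⟨ ℚ∑.∑<-cong (suc n) (λ i _ → ℚ.*-distribʳ-+ (h (n ∸ i)) (f i) (g i)) ⟩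
  ℚ∑.∑< (λ i → f i *ℚ h (n ∸ i) +ℚ g i *ℚ h (n ∸ i)) (suc n)
    ≡⟨ ℚ∑.∑<-distrib (λ i → f i *ℚ h (n ∸ i)) (λ i → g i *ℚ h (n ∸ i)) (suc n) ⟩
  ℚ∑.∑< (λ i → f i *ℚ h (n ∸ i)) (suc n) +ℚ ℚ∑.∑< (λ i → g i *ℚ h (n ∸ i)) (suc n)
    ≡⟨ cong₂ _+ℚ_ (⊛-∑ f h n) (⊛-∑ g h n) ⟨
  (f ⊛ h) n +ℚ (g ⊛ h) n ∎
  where open ≡-Reasoning

⊛-distribʳ-⊖ : ∀ f g h n → ((f ⊖ g) ⊛ h) n ≡ (f ⊛ h) n -ℚ (g ⊛ h) n
⊛-distribʳ-⊖ f g h n = begin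
  ((f ⊖ g) ⊛ h) n                      ≡⟨ ⊛-distribʳ-⊕ f (λ i → ℚ.- g i) h n ⟩
  (f ⊛ h) n +ℚ ((λ i → ℚ.- g i) ⊛ h) n ≡⟨ cong ((f ⊛ h) n +ℚ_) negated ⟩
  (f ⊛ h) n -ℚ (g ⊛ h) n               ∎
  where
  open ≡-Reasoning
  negated : ((λ i → ℚ.- g i) ⊛ h) n ≡ ℚ.- (g ⊛ h) n
  negated = begin
    ((λ i → ℚ.- g i) ⊛ h) n                      ≡⟨ ⊛-∑ (λ i → ℚ.- g i) h n ⟩
    ℚ∑.∑< (λ i → ℚ.- g i *ℚ h (n ∸ i)) (suc n)   ≡⟨ ℚ∑.∑<-cong (suc n) (λ i _ → ℚ.neg-distribˡ-* (g i) (h (n ∸ i))) ⟨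
    ℚ∑.∑< (λ i → ℚ.- (g i *ℚ h (n ∸ i))) (suc n) ≡⟨ ∑<-neg (λ i → g i *ℚ h (n ∸ i)) (suc n) ⟩
    ℚ.- ℚ∑.∑< (λ i → g i *ℚ h (n ∸ i)) (suc n)   ≡⟨ cong ℚ.-_ (⊛-∑ g h n) ⟨
    ℚ.- (g ⊛ h) n                                ∎

const-⊛ : ∀ c h n → (const c ⊛ h) n ≡ c *ℚ h n
const-⊛ c h n = begin
  (const c ⊛ h) n
    ≡⟨ ⊛-∑ (const c) h n ⟩
  c *ℚ h n +ℚ ℚ∑.∑< (λ i → 0ℚ *ℚ h (n ∸ suc i)) n
    ≡⟨ cong (c *ℚ h n +ℚ_) (ℚ∑.∑<-zero _ n (λ i _ → ℚ.*-zeroˡ (h (n ∸ suc i)))) ⟩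
  c *ℚ h n +ℚ 0ℚ
    ≡⟨ ℚ.+-identityʳ _ ⟩
  c *ℚ h n ∎
  where open ≡-Reasoning

X^-diagonal : ∀ c → X^ c c ≡ 1ℚ
X^-diagonal c with c ≟ c
... | yes _   = refl
... | no  c≢c = ⊥-elim (c≢c refl)

X^-off-diagonal : ∀ c i → c ≢ i → X^ c i ≡ 0ℚ
X^-off-diagonal c i c≢i with c ≟ i
... | yes c≡i = ⊥-elim (c≢i c≡i)
... | no  _   = refl

X^-suc : ∀ c i → X^ (suc c) (suc i) ≡ X^ c i
X^-suc c i with c ≟ i
... | yes refl = X^-diagonal (suc c)
... | no  c≢i  = X^-off-diagonal (suc c) (suc i) (c≢i ∘ suc-injective)

∑<-X^-< : ∀ c (h : ℕ → ℚ) m → c < m → ℚ∑.∑< (λ i → X^ c i *ℚ h i) m ≡ h c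
∑<-X^-< zero    h (suc m) _ = begin
  X^ 0 0 *ℚ h 0 +ℚ ℚ∑.∑< (λ i → X^ 0 (suc i) *ℚ h (suc i)) m
    ≡⟨ cong₂ _+ℚ_ (cong (_*ℚ h 0) (X^-diagonal 0)) (ℚ∑.∑<-zero _ m (λ i _ →
         trans (cong (_*ℚ h (suc i)) (X^-off-diagonal 0 (suc i) (λ ()))) (ℚ.*-zeroˡ (h (suc i))))) ⟩
  1ℚ *ℚ h 0 +ℚ 0ℚ
    ≡⟨ trans (ℚ.+-identityʳ _) (ℚ.*-identityˡ (h 0)) ⟩
  h 0 ∎
  where open ≡-Reasoning
∑<-X^-< (suc c) h (suc m) (s≤s c<m) = begin
  X^ (suc c) 0 *ℚ h 0 +ℚ ℚ∑.∑< (λ i → X^ (suc c) (suc i) *ℚ h (suc i)) m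
    ≡⟨ cong₂ _+ℚ_ (trans (cong (_*ℚ h 0) (X^-off-diagonal (suc c) 0 (λ ()))) (ℚ.*-zeroˡ (h 0)))
                  (ℚ∑.∑<-cong m (λ i _ → cong (_*ℚ h (suc i)) (X^-suc c i))) ⟩
  0ℚ +ℚ ℚ∑.∑< (λ i → X^ c i *ℚ h (suc i)) m
    ≡⟨ trans (ℚ.+-identityˡ _) (∑<-X^-< c (λ i → h (suc i)) m c<m) ⟩
  h (suc c) ∎
  where open ≡-Reasoning

∑<-X^-≥ : ∀ c (h : ℕ → ℚ) m → m ≤ c → ℚ∑.∑< (λ i → X^ c i *ℚ h i) m ≡ 0ℚ
∑<-X^-≥ c h m m≤c = ℚ∑.∑<-zero (λ i → X^ c i *ℚ h i) m (λ i i<m →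
  trans (cong (_*ℚ h i) (X^-off-diagonal c i (λ { refl → <⇒≱ i<m m≤c }))) (ℚ.*-zeroˡ (h i)))

X^-⊛-≤ : ∀ c h n → c ≤ n → (X^ c ⊛ h) n ≡ h (n ∸ c)
X^-⊛-≤ c h n c≤n = trans (⊛-∑ (X^ c) h n) (∑<-X^-< c (λ i → h (n ∸ i)) (suc n) (s≤s c≤n))

X^-⊛-> : ∀ c h n → n < c → (X^ c ⊛ h) n ≡ 0ℚ
X^-⊛-> c h n n<c = trans (⊛-∑ (X^ c) h n) (∑<-X^-≥ c (λ i → h (n ∸ i)) (suc n) n<c)

X^-⊛-inv1-x : ∀ c j → (X^ c ⊛ inv1-x) j ≡ (if j <ᵇ c then 0ℚ else 1ℚ)
X^-⊛-inv1-x c j with j <ᵇ c | <ᵇ-reflects-< j c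
... | true  | ofʸ j<c = X^-⊛-> c inv1-x j j<c
... | false | ofⁿ j≮c = X^-⊛-≤ c inv1-x j (≮⇒≥ j≮c)

inv1-x-⊛-inv1-x : ∀ n → (inv1-x ⊛ inv1-x) n ≡ fromℕ (suc n)
inv1-x-⊛-inv1-x n = trans (⊛-∑ inv1-x inv1-x n) (ones (suc n))
  where
  ones : ∀ m → ℚ∑.∑< (λ _ → 1ℚ *ℚ 1ℚ) m ≡ fromℕ m
  ones zero    = refl
  ones (suc m) = trans (cong (1ℚ *ℚ 1ℚ +ℚ_) (ones m)) (sym (fromℕ-+ 1 m))

X^-⊛-inv1-x² : ∀ c n → (X^ c ⊛ (inv1-x ⊛ inv1-x)) n ≡ fromℕ (suc n ∸ c)
X^-⊛-inv1-x² c n with c ≤? n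
... | yes c≤n = trans (X^-⊛-≤ c (inv1-x ⊛ inv1-x) n c≤n) (trans (inv1-x-⊛-inv1-x (n ∸ c)) (cong fromℕ (sym (+-∸-assoc 1 c≤n))))
... | no  c≰n = trans (X^-⊛-> c (inv1-x ⊛ inv1-x) n (≰⇒> c≰n)) (cong fromℕ (sym (m≤n⇒m∸n≡0 (≰⇒> c≰n))))

weight-series : ∀ k ℓ j → ((const (+ 2 / 1) ⊖ X^ k ⊖ X^ ℓ) ⊛ inv1-x) j ≡ fromℕ (weight k ℓ j)
weight-series k ℓ j
  rewrite ⊛-distribʳ-⊖ (const (+ 2 / 1) ⊖ X^ k) (X^ ℓ) inv1-x j | ⊛-distribʳ-⊖ (const (+ 2 / 1)) (X^ k) inv1-x j
        | const-⊛ (+ 2 / 1) inv1-x j | X^-⊛-inv1-x k j | X^-⊛-inv1-x ℓ j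
  with j <ᵇ k | j <ᵇ ℓ
... | true  | true  = refl
... | true  | false = refl
... | false | true  = refl
... | false | false = refl

bothSidesShort-series : ∀ k ℓ n →
  ((const 1ℚ ⊖ X^ k ⊖ X^ ℓ ⊕ X^ (k + ℓ)) ⊛ (inv1-x ⊛ inv1-x)) n ≡ fromℕ (bothSidesShort k ℓ n)
bothSidesShort-series k ℓ n = begin
  ((const 1ℚ ⊖ X^ k ⊖ X^ ℓ ⊕ X^ (k + ℓ)) ⊛ V) n
    ≡⟨ ⊛-distribʳ-⊕ (const 1ℚ ⊖ X^ k ⊖ X^ ℓ) (X^ (k + ℓ)) V n ⟩
  ((const 1ℚ ⊖ X^ k ⊖ X^ ℓ) ⊛ V) n +ℚ (X^ (k + ℓ) ⊛ V) n
    ≡⟨ cong (_+ℚ (X^ (k + ℓ) ⊛ V) n) (trans (⊛-distribʳ-⊖ (const 1ℚ ⊖ X^ k) (X^ ℓ) V n)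
                                              (cong (_-ℚ (X^ ℓ ⊛ V) n) (⊛-distribʳ-⊖ (const 1ℚ) (X^ k) V n))) ⟩
  (((const 1ℚ ⊛ V) n -ℚ (X^ k ⊛ V) n) -ℚ (X^ ℓ ⊛ V) n) +ℚ (X^ (k + ℓ) ⊛ V) n
    ≡⟨ cong₂ (λ x z → ((x -ℚ (X^ k ⊛ V) n) -ℚ (X^ ℓ ⊛ V) n) +ℚ z)
             (trans (const-⊛ 1ℚ V n) (trans (ℚ.*-identityˡ (V n)) (inv1-x-⊛-inv1-x n))) (X^-⊛-inv1-x² (k + ℓ) n) ⟩
  ((fromℕ N -ℚ (X^ k ⊛ V) n) -ℚ (X^ ℓ ⊛ V) n) +ℚ fromℕ d
    ≡⟨ cong₂ (λ x y → ((fromℕ N -ℚ x) -ℚ y) +ℚ fromℕ d) (X^-⊛-inv1-x² k n) (X^-⊛-inv1-x² ℓ n) ⟩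
  ((fromℕ N -ℚ fromℕ a) -ℚ fromℕ b) +ℚ fromℕ d
    ≡⟨ solve-for (fromℕ c) (fromℕ a) (fromℕ b) (fromℕ N) (fromℕ d) closed ⟨
  fromℕ c ∎
  where
  open ≡-Reasoning
  open +-*-Solver using (solve; _:=_; _:+_; _:-_)
  V : Series
  V = inv1-x ⊛ inv1-x
  N c a b d : ℕ
  N = suc n
  c = bothSidesShort k ℓ n
  a = N ∸ k
  b = N ∸ ℓ
  d = N ∸ (k + ℓ)
  closed : fromℕ c +ℚ fromℕ a +ℚ fromℕ b ≡ fromℕ N +ℚ fromℕ d
  closed = begin
    fromℕ c +ℚ fromℕ a +ℚ fromℕ b ≡⟨ cong (_+ℚ fromℕ b) (fromℕ-+ c a) ⟨
    fromℕ (c + a) +ℚ fromℕ b       ≡⟨ fromℕ-+ (c + a) b ⟨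
    fromℕ (c + a + b)              ≡⟨ cong fromℕ (bothSidesShort-closed k ℓ n) ⟩
    fromℕ (N + d)                  ≡⟨ fromℕ-+ N d ⟩
    fromℕ N +ℚ fromℕ d             ∎
  solve-for : ∀ c x y s z → c +ℚ x +ℚ y ≡ s +ℚ z → c ≡ ((s -ℚ x) -ℚ y) +ℚ z
  solve-for c x y s z eq = begin
    c                         ≡⟨ solve 3 (λ c x y → c := ((c :+ x :+ y) :- x) :- y) refl c x y ⟩
    ((c +ℚ x +ℚ y) -ℚ x) -ℚ y ≡⟨ cong (λ t → (t -ℚ x) -ℚ y) eq ⟩
    ((s +ℚ z) -ℚ x) -ℚ y      ≡⟨ solve 4 (λ s z x y → ((s :+ z) :- x) :- y := ((s :- x) :- y) :+ z) refl s z x y ⟩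
    ((s -ℚ x) -ℚ y) +ℚ z      ∎

factorial⁻¹ : ℕ → ℚ
factorial⁻¹ n = (+ 1 / n !) {{n !≢0}}

deriv-egf : ∀ f n → deriv (egf f) n ≡ fromℕ (f (suc n)) *ℚ factorial⁻¹ n
deriv-egf f n = begin
  fromℕ (suc n) *ℚ egf f (suc n)
    ≡⟨ cong (fromℕ (suc n) *ℚ_) (/-as-* (f (suc n)) (suc n !) {{suc n !≢0}}) ⟩
  fromℕ (suc n) *ℚ (fromℕ (f (suc n)) *ℚ factorial⁻¹ (suc n))
    ≡⟨ ℚ*.x∙yz≈y∙xz (fromℕ (suc n)) (fromℕ (f (suc n))) (factorial⁻¹ (suc n)) ⟩
  fromℕ (f (suc n)) *ℚ (fromℕ (suc n) *ℚ factorial⁻¹ (suc n))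
    ≡⟨ cong (fromℕ (f (suc n)) *ℚ_) (1/-rescale (suc n) (n !) (suc n !) {{n !≢0}} {{suc n !≢0}} refl) ⟨
  fromℕ (f (suc n)) *ℚ factorial⁻¹ n ∎
  where open ≡-Reasoning

egf-rescale : ∀ f n j → j ≤ n → egf f (n ∸ j) ≡ fromℕ (fallingFactorial n j * f (n ∸ j)) *ℚ factorial⁻¹ n
egf-rescale f n j j≤n = begin
  egf f (n ∸ j)
    ≡⟨ /-as-* (f (n ∸ j)) ((n ∸ j) !) {{(n ∸ j) !≢0}} ⟩
  fromℕ (f (n ∸ j)) *ℚ factorial⁻¹ (n ∸ j)
    ≡⟨ cong (fromℕ (f (n ∸ j)) *ℚ_) rescaled ⟩
  fromℕ (f (n ∸ j)) *ℚ (fromℕ (fallingFactorial n j) *ℚ factorial⁻¹ n)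
    ≡⟨ ℚ*.x∙yz≈yx∙z (fromℕ (f (n ∸ j))) (fromℕ (fallingFactorial n j)) (factorial⁻¹ n) ⟩
  (fromℕ (fallingFactorial n j) *ℚ fromℕ (f (n ∸ j))) *ℚ factorial⁻¹ n
    ≡⟨ cong (_*ℚ factorial⁻¹ n) (fromℕ-* (fallingFactorial n j) (f (n ∸ j))) ⟨
  fromℕ (fallingFactorial n j * f (n ∸ j)) *ℚ factorial⁻¹ n ∎
  where
  open ≡-Reasoning
  rescaled : factorial⁻¹ (n ∸ j) ≡ fromℕ (fallingFactorial n j) *ℚ factorial⁻¹ n
  rescaled = 1/-rescale (fallingFactorial n j) ((n ∸ j) !) (n !) {{(n ∸ j) !≢0}} {{n !≢0}} (fallingFactorial-! n j j≤n)

weighted-series : ∀ k ℓ n →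
  ((const (+ 2 / 1) ⊖ X^ k ⊖ X^ ℓ) ⊛ inv1-x ⊛ egf (A k ℓ)) n ≡ deriv (egf (A k ℓ)) n +ℚ fromℕ (bothSidesShort k ℓ n)
weighted-series k ℓ n = begin
  (W ⊛ egf (A k ℓ)) n
    ≡⟨ ⊛-∑ W (egf (A k ℓ)) n ⟩
  ℚ∑.∑< (λ j → W j *ℚ egf (A k ℓ) (n ∸ j)) (suc n)
    ≡⟨ ℚ∑.∑<-cong (suc n) (λ j j<1+n → term j (≤-pred j<1+n)) ⟩
  ℚ∑.∑< (λ j → fromℕ (summand j) *ℚ I) (suc n)
    ≡⟨ ∑<-*ʳ (λ j → fromℕ (summand j)) I (suc n) ⟩
  ℚ∑.∑< (λ j → fromℕ (summand j)) (suc n) *ℚ I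
    ≡⟨ cong (_*ℚ I) (fromℕ-∑ summand (suc n)) ⟨
  fromℕ (∑< summand (suc n)) *ℚ I
    ≡⟨ cong (λ m → fromℕ m *ℚ I) (A-recurrence k ℓ n) ⟨
  fromℕ (A k ℓ (suc n) + n ! * bothSidesShort k ℓ n) *ℚ I
    ≡⟨ cong (_*ℚ I) (trans (fromℕ-+ (A k ℓ (suc n)) _) (cong (fromℕ (A k ℓ (suc n)) +ℚ_) (fromℕ-* (n !) _))) ⟩
  (fromℕ (A k ℓ (suc n)) +ℚ fromℕ (n !) *ℚ c) *ℚ I
    ≡⟨ ℚ.*-distribʳ-+ I (fromℕ (A k ℓ (suc n))) (fromℕ (n !) *ℚ c) ⟩
  fromℕ (A k ℓ (suc n)) *ℚ I +ℚ (fromℕ (n !) *ℚ c) *ℚ I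
    ≡⟨ cong₂ _+ℚ_ (deriv-egf (A k ℓ) n) (sym n!*c*I≡c) ⟨
  deriv (egf (A k ℓ)) n +ℚ c ∎
  where
  open ≡-Reasoning
  W : Series
  W = (const (+ 2 / 1) ⊖ X^ k ⊖ X^ ℓ) ⊛ inv1-x
  I c : ℚ
  I = factorial⁻¹ n
  c = fromℕ (bothSidesShort k ℓ n)
  n!*c*I≡c : (fromℕ (n !) *ℚ c) *ℚ I ≡ c
  n!*c*I≡c = begin
    (fromℕ (n !) *ℚ c) *ℚ I ≡⟨ ℚ*.xy∙z≈y∙xz (fromℕ (n !)) c I ⟩
    c *ℚ (fromℕ (n !) *ℚ I) ≡⟨ cong (c *ℚ_) (fromℕ-*-1/ (n !) {{n !≢0}}) ⟩
    c *ℚ 1ℚ                 ≡⟨ ℚ.*-identityʳ c ⟩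
    c                       ∎
  summand : ℕ → ℕ
  summand j = weight k ℓ j * (fallingFactorial n j * A k ℓ (n ∸ j))
  term : ∀ j → j ≤ n → W j *ℚ egf (A k ℓ) (n ∸ j) ≡ fromℕ (summand j) *ℚ I
  term j j≤n = begin
    W j *ℚ egf (A k ℓ) (n ∸ j)
      ≡⟨ cong₂ _*ℚ_ (weight-series k ℓ j) (egf-rescale (A k ℓ) n j j≤n) ⟩
    fromℕ (weight k ℓ j) *ℚ (fromℕ (fallingFactorial n j * A k ℓ (n ∸ j)) *ℚ I)
      ≡⟨ ℚ.*-assoc (fromℕ (weight k ℓ j)) _ I ⟨
    (fromℕ (weight k ℓ j) *ℚ fromℕ (fallingFactorial n j * A k ℓ (n ∸ j))) *ℚ I
      ≡⟨ cong (_*ℚ I) (fromℕ-* (weight k ℓ j) _) ⟨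
    fromℕ (summand j) *ℚ I ∎

mainTheorem7 : (k ℓ : ℕ) →
    (deriv (egf (A k ℓ))
      ≐ (const (+ 2 / 1) ⊖ X^ k ⊖ X^ ℓ) ⊛ inv1-x ⊛ egf (A k ℓ)
        ⊖ (const 1ℚ ⊖ X^ k ⊖ X^ ℓ ⊕ X^ (k + ℓ)) ⊛ (inv1-x ⊛ inv1-x))
    × at0 (egf (A k ℓ)) ≡ 1ℚ
mainTheorem7 k ℓ = coefficient , refl
  where
  coefficient : ∀ n → deriv (egf (A k ℓ)) n
                    ≡ ((const (+ 2 / 1) ⊖ X^ k ⊖ X^ ℓ) ⊛ inv1-x ⊛ egf (A k ℓ)) n
                      -ℚ ((const 1ℚ ⊖ X^ k ⊖ X^ ℓ ⊕ X^ (k + ℓ)) ⊛ (inv1-x ⊛ inv1-x)) n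
  coefficient n = begin
    deriv (egf (A k ℓ)) n
      ≡⟨ ℚ+.//-rightDividesʳ c (deriv (egf (A k ℓ)) n) ⟨
    (deriv (egf (A k ℓ)) n +ℚ c) -ℚ c
      ≡⟨ cong₂ _-ℚ_ (weighted-series k ℓ n) (bothSidesShort-series k ℓ n) ⟨
    ((const (+ 2 / 1) ⊖ X^ k ⊖ X^ ℓ) ⊛ inv1-x ⊛ egf (A k ℓ)) n
      -ℚ ((const 1ℚ ⊖ X^ k ⊖ X^ ℓ ⊕ X^ (k + ℓ)) ⊛ (inv1-x ⊛ inv1-x)) n ∎
    where
    open ≡-Reasoning
    c : ℚ
    c = fromℕ (bothSidesShort k ℓ n)
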